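{- Let $q$ be a prime power and $d,n\ge1$ integers. Let $f=y^n+a_{n-1}(x)y^{n-1}+\cdots+a_0(x)\in\mathbb{F}_q[x][y]$ with $a_0,\ldots,a_{n-1}$ chosen independently and uniformly from the polynomials in $\mathbb{F}_q[x]$ of degree at most $d$. Then for every $0\le k<n$, $$\mathbb{P}\bigl(\deg_y(\mathrm{con}_x(f))=k\bigr)=\left(1-\frac1{q^d}\right)\frac{1}{q^{dk}}.$$
   Context: $\mathrm{con}_x(f)\in\mathbb{F}_q[y]$ is the monic gcd of the coefficients of $f$ viewed as a polynomial in $x$ over $\mathbb{F}_q[y]$. -}

module Defs where

open import Level using (0ℓ)
open import Data.Nat using (ℕ; zero; suc)
open import Data.Fin using (Fin)
import Data.Fin as Fin
open import Data.List using (List; []; _∷_; _++_; map; length; filter; concatMap; tabulate; [_])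
open import Data.List.Relation.Unary.All using (All)
open import Data.List.Membership.Propositional using (_∈_)
open import Data.Product using (Σ; _×_; _,_)
open import Relation.Unary using (Pred; Decidable)
open import Relation.Binary.PropositionalEquality using (_≡_; _≢_)
open import Relation.Binary.Definitions using (DecidableEquality)
open import Algebra.Structures using (IsCommutativeRing)
open import Function.Bundles using (_↔_; Inverse)

-- A finite field with exactly q elements (q is then necessarily a
-- prime power, and every prime power q arises; F_q is unique up to
-- isomorphism).

record FiniteField (q : ℕ) : Set₁ where
  infixl 7 _*_
  infixl 6 _+_
  field
    F     : Set
    _+_   : F → F → F
    _*_   : F → F → F
    -_    : F → F
    0#    : F
    1#    : F
    isCommutativeRing : IsCommutativeRing _≡_ _+_ _*_ -_ 0# 1#
    0≢1   : 0# ≢ 1#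
    inverse : ∀ x → x ≢ 0# → Σ F (λ y → x * y ≡ 1#)
    _≟_   : DecidableEquality F
    enum  : Fin q ↔ F

  elements : List F
  elements = tabulate (Inverse.to enum)

  -- Univariate polynomials over F (in the variable y), as coefficient
  -- lists, constant term first.  Trailing zeros are allowed; equality
  -- of polynomials is _≈ₚ_ below.

  Poly : Set
  Poly = List F

  infixl 6 _+ₚ_
  infixl 7 _*ₚ_
  _+ₚ_ : Poly → Poly → Poly
  []      +ₚ r       = r
  (a ∷ p) +ₚ []      = a ∷ p
  (a ∷ p) +ₚ (b ∷ r) = (a + b) ∷ (p +ₚ r)

  -ₚ_ : Poly → Poly
  -ₚ_ = map -_

  _*ₚ_ : Poly → Poly → Poly
  []      *ₚ r = []
  (a ∷ p) *ₚ r = map (a *_) r +ₚ (0# ∷ (p *ₚ r))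

  _≈ₚ_ : Poly → Poly → Set
  p ≈ₚ r = All (_≡ 0#) (p +ₚ (-ₚ r))

  _∣ₚ_ : Poly → Poly → Set
  g ∣ₚ p = Σ Poly (λ h → (g *ₚ h) ≈ₚ p)

  IsMonicGCD : List Poly → Poly → Set
  IsMonicGCD cs g =
    (∀ c → c ∈ cs → g ∣ₚ c) ×
    (∀ h → (∀ c → c ∈ cs → h ∣ₚ c) → h ∣ₚ g)

  -- "the monic gcd of cs has degree k": it is c₀ + c₁y + … + c_{k-1}y^{k-1} + y^k
  GCDDegree : List Poly → ℕ → Set
  GCDDegree cs k = Σ (List F) (λ c → (length c ≡ k) × IsMonicGCD cs (c ++ [ 1# ]))

  -- The random polynomial f = y^n + a_{n-1}(x) y^{n-1} + … + a_0(x),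
  -- deg a_i ≤ d, is encoded by its coefficient table
  --   a : Fin n → Fin (suc d) → F,   a i j = coefficient of x^j in a_i.

  -- coefficient of y^i x^j in f, for i ≤ n, j ≤ d
  fCoeff : {n d : ℕ} → (Fin n → Fin (suc d) → F) → Fin (suc n) → Fin (suc d) → F
  fCoeff {zero}  a Fin.zero    Fin.zero    = 1#
  fCoeff {zero}  a Fin.zero    (Fin.suc _) = 0#
  fCoeff {suc n} a Fin.zero    j = a Fin.zero j
  fCoeff {suc n} a (Fin.suc i) j = fCoeff {n} (λ i' → a (Fin.suc i')) i j

  -- f viewed as a polynomial in x over F[y]: its x-coefficients c_0(y), …, c_d(y)
  xCoeffs : {n d : ℕ} → (Fin n → Fin (suc d) → F) → List Poly
  xCoeffs {n} {d} a = tabulate {n = suc d} (λ j → tabulate {n = suc n} (λ i → fCoeff a i j))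

  DegCon≡ : (n d k : ℕ) → Pred (Fin n → Fin (suc d) → F) 0ℓ
  DegCon≡ n d k a = GCDDegree (xCoeffs a) k

  -- The sample space: all tuples (a_0,…,a_{n-1}), each exactly once.

  allFuns : {A : Set} → (m : ℕ) → List A → List (Fin m → A)
  allFuns zero    as = [ (λ ()) ]
  allFuns (suc m) as = concatMap (λ x → map (λ g → λ { Fin.zero → x ; (Fin.suc i) → g i }) (allFuns m as)) as

  sampleSpace : (n d : ℕ) → List (Fin n → Fin (suc d) → F)
  sampleSpace n d = allFuns n (allFuns (suc d) elements)

count : {A : Set} {P : Pred A 0ℓ} → Decidable P → List A → ℕ
count dec xs = length (filter dec xs)

-- Write f = c₀(y) + c₁(y) x + … + c_d(y) x^d. Then con_x f is the monic gcd of the columns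
-- c₀, …, c_d, where c₀ is monic of degree n and c₁, …, c_d have degree < n; it is computed by the
-- Euclidean algorithm, which also makes "deg con_x f = k" decidable. Let N(m, k) count the column
-- tuples of height m whose gcd has degree k. Multiplying every column by a monic polynomial of
-- degree k maps the tuples of height j with coprime columns bijectively onto the tuples of height
-- k + j whose gcd is that polynomial, so N(k + j, k) = q^k N(j, 0). Summing over k, the
-- q^{m(d+1)} tuples of height m satisfy q^{(j+1)(d+1)} = N(j + 1, 0) + q · q^{j(d+1)}, which gives
-- N(j + 1, 0) = q^{j(d+1)+1} (q^d − 1) and hence the formula.
module Submission where

open import Defs

open import Level using (0ℓ)
open import Data.Nat as ℕ using (ℕ; zero; suc; z≤n; s≤s)
import Data.Nat.Properties as ℕₚ
open import Data.Nat.ListAction using (sum)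
open import Data.Fin using (Fin; zero; suc; toℕ)
open import Data.List as List using (List; []; _∷_; _++_; [_]; length; map; filter; cartesianProductWith; applyUpTo; upTo)
import Data.List.Properties as Listₚ
import Data.List.Relation.Unary.All.Properties as Allₚ
open import Data.List.Membership.Propositional using (_∈_)
import Data.List.Membership.Propositional.Properties as ∈ₚ
open import Data.List.Membership.Propositional.Properties.WithK using (unique∧set⇒bag)
open import Data.List.Relation.Binary.BagAndSetEquality using (∼bag⇒↭)
open import Data.List.Relation.Binary.Permutation.Propositional.Properties using (↭-length)
open import Data.List.Relation.Unary.All as All using (All; []; _∷_)
open import Data.List.Relation.Unary.Any using (here; there)
open import Data.List.Relation.Unary.Unique.Propositional using (Unique)
open import Data.List.Relation.Unary.AllPairs as AllPairs using ()
import Data.List.Relation.Unary.Unique.Propositional.Properties as Uniqueₚ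
open import Data.Vec as Vec using (Vec; []; _∷_)
import Data.Vec.Properties as Vecₚ
open import Data.Vec.Relation.Binary.Equality.Cast using (cast-is-id)
open import Data.Product using (Σ; Σ-syntax; _,_; proj₁; proj₂; _×_)
open import Data.Empty using (⊥-elim)
open import Data.Sum using (_⊎_; inj₁; inj₂)
open import Function using (_∘_; id; case_of_)
open import Function.Bundles using (mk⇔; Inverse)
open import Relation.Nullary using (yes; no; ¬_)
open import Relation.Nullary.Decidable using (map′)
open import Relation.Unary using (Pred; Decidable; _≐_; U)
open import Relation.Unary.Properties using (U?)
open import Data.Unit using (tt)
open import Relation.Binary.PropositionalEquality hiding ([_])
open import Data.Nat.Solver using (module +-*-Solver)
open import Algebra.Bundles using (CommutativeRing)
import Algebra.Properties.Ring as RingProperties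
open import Data.Maybe using (nothing)
open import Algebra.Properties.CommutativeSemigroup ℕₚ.+-commutativeSemigroup using () renaming (interchange to +-interchange)

sum-map-zero : {X : Set} (xs : List X) → sum (map (λ _ → 0) xs) ≡ 0
sum-map-zero [] = refl
sum-map-zero (_ ∷ xs) = sum-map-zero xs

sum-map-+ : {X : Set} (f g : X → ℕ) (xs : List X) → sum (map (λ x → f x ℕ.+ g x) xs) ≡ sum (map f xs) ℕ.+ sum (map g xs)
sum-map-+ f g [] = refl
sum-map-+ f g (x ∷ xs) = begin
  f x ℕ.+ g x ℕ.+ sum (map (λ x → f x ℕ.+ g x) xs)    ≡⟨ cong (f x ℕ.+ g x ℕ.+_) (sum-map-+ f g xs) ⟩
  f x ℕ.+ g x ℕ.+ (sum (map f xs) ℕ.+ sum (map g xs)) ≡⟨ +-interchange (f x) (g x) _ _ ⟩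
  f x ℕ.+ sum (map f xs) ℕ.+ (g x ℕ.+ sum (map g xs)) ∎
  where open ≡-Reasoning

sum-map-const : {X : Set} (f : X → ℕ) {c : ℕ} → (∀ x → f x ≡ c) → (xs : List X) → sum (map f xs) ≡ length xs ℕ.* c
sum-map-const f f≡c [] = refl
sum-map-const f f≡c (x ∷ xs) = cong₂ ℕ._+_ (f≡c x) (sum-map-const f f≡c xs)

sum-map-* : ∀ c (xs : List ℕ) → sum (map (c ℕ.*_) xs) ≡ c ℕ.* sum xs
sum-map-* c [] = sym (ℕₚ.*-zeroʳ c)
sum-map-* c (x ∷ xs) = trans (cong (c ℕ.* x ℕ.+_) (sum-map-* c xs)) (sym (ℕₚ.*-distribˡ-+ c x (sum xs)))

applyUpTo-cong : {A : Set} {f g : ℕ → A} → ∀ n → (∀ {k} → k ℕ.< n → f k ≡ g k) → applyUpTo f n ≡ applyUpTo g n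
applyUpTo-cong zero    f≡g = refl
applyUpTo-cong (suc n) f≡g = cong₂ _∷_ (f≡g (s≤s z≤n)) (applyUpTo-cong n (f≡g ∘ s≤s))

module _ {A : Set} where

  count-++ : ∀ {P : Pred A 0ℓ} (P? : Decidable P) xs ys → count P? (xs ++ ys) ≡ count P? xs ℕ.+ count P? ys
  count-++ P? xs ys = trans (cong length (Listₚ.filter-++ P? xs ys)) (Listₚ.length-++ (filter P? xs))

  count-as-sum : ∀ {P : Pred A 0ℓ} (P? : Decidable P) xs → count P? xs ≡ sum (map (λ x → count P? [ x ]) xs)
  count-as-sum P? []       = refl
  count-as-sum P? (x ∷ xs) = trans (count-++ P? [ x ] xs) (cong (count P? [ x ] ℕ.+_) (count-as-sum P? xs))

  count-≐ : ∀ {P Q : Pred A 0ℓ} (P? : Decidable P) (Q? : Decidable Q) → P ≐ Q → ∀ xs → count P? xs ≡ count Q? xs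
  count-≐ P? Q? P≐Q xs = cong length (Listₚ.filter-≐ P? Q? P≐Q xs)

  count-all : ∀ {P : Pred A 0ℓ} (P? : Decidable P) {xs} → All P xs → count P? xs ≡ length xs
  count-all P? all = cong length (Listₚ.filter-all P? all)

  count-none : ∀ {P : Pred A 0ℓ} (P? : Decidable P) {xs} → All (¬_ ∘ P) xs → count P? xs ≡ 0
  count-none P? none = cong length (Listₚ.filter-none P? none)

  count-unique : ∀ {P : Pred A 0ℓ} (P? : Decidable P) {xs x} → Unique xs → x ∈ xs → P x → (∀ {y} → P y → y ≡ x) →
                 count P? xs ≡ 1
  count-unique P? {y ∷ xs} (y∉xs AllPairs.∷ _) (here refl) px only with P? y
  ... | yes _ = cong suc (count-none P? (All.map (λ y≢z pz → y≢z (sym (only pz))) y∉xs))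
  ... | no ¬px = ⊥-elim (¬px px)
  count-unique P? {y ∷ xs} (y∉xs AllPairs.∷ u) (there x∈xs) px only with P? y
  ... | yes py = ⊥-elim (All.lookup y∉xs x∈xs (only py))
  ... | no _ = count-unique P? u x∈xs px only

  unique-length : {xs ys : List A} → Unique xs → Unique ys →
                  (∀ {x} → x ∈ xs → x ∈ ys) → (∀ {x} → x ∈ ys → x ∈ xs) → length xs ≡ length ys
  unique-length u v xs⊆ys ys⊆xs = ↭-length (∼bag⇒↭ (unique∧set⇒bag u v (mk⇔ xs⊆ys ys⊆xs)))

module _ {A B : Set} where

  count-map : ∀ {P : Pred B 0ℓ} (P? : Decidable P) (f : A → B) xs → count P? (map f xs) ≡ count (P? ∘ f) xs
  count-map P? f [] = refl
  count-map P? f (x ∷ xs) with P? (f x)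
  ... | yes _ = cong suc (count-map P? f xs)
  ... | no _ = count-map P? f xs

  count-bijection : (f : A → B) → (∀ {x y} → f x ≡ f y → x ≡ y) →
                    {as : List A} {bs : List B} → Unique as → Unique bs → (∀ a → a ∈ as) → (∀ b → b ∈ bs) →
                    ∀ {P : Pred B 0ℓ} (P? : Decidable P) → (∀ {b} → P b → Σ A (λ a → f a ≡ b)) →
                    count P? bs ≡ count (P? ∘ f) as
  count-bijection f f-inj {as} {bs} as! bs! ∈as ∈bs P? P⊆image =
    trans (unique-length (Uniqueₚ.filter⁺ P? bs!) (Uniqueₚ.filter⁺ P? (Uniqueₚ.map⁺ f-inj as!)) ⊆image ⊆bs)
          (count-map P? f as)
    where
    ⊆image : ∀ {b} → b ∈ filter P? bs → b ∈ filter P? (map f as)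
    ⊆image b∈ with ∈ₚ.∈-filter⁻ P? {xs = bs} b∈
    ... | _ , pb with P⊆image pb
    ... | a , refl = ∈ₚ.∈-filter⁺ P? (∈ₚ.∈-map⁺ f (∈as a)) pb
    ⊆bs : ∀ {b} → b ∈ filter P? (map f as) → b ∈ filter P? bs
    ⊆bs b∈ = ∈ₚ.∈-filter⁺ P? (∈bs _) (proj₂ (∈ₚ.∈-filter⁻ P? {xs = map f as} b∈))

  count-fibres : ∀ {P : Pred A 0ℓ} (P? : Decidable P) {Q : B → Pred A 0ℓ} (Q? : ∀ b → Decidable (Q b)) (bs : List B) →
                 (∀ {a} → P a → count (λ b → Q? b a) bs ≡ 1) → (∀ {a} → ¬ P a → count (λ b → Q? b a) bs ≡ 0) →
                 ∀ as → count P? as ≡ sum (map (λ b → count (Q? b) as) bs)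
  count-fibres P? Q? bs one none [] = sym (sum-map-zero bs)
  count-fibres P? Q? bs one none (a ∷ as) = begin
    count P? (a ∷ as)
      ≡⟨ count-++ P? [ a ] as ⟩
    count P? [ a ] ℕ.+ count P? as
      ≡⟨ cong₂ ℕ._+_ fibre (sym (count-fibres P? Q? bs one none as)) ⟨
    count (λ b → Q? b a) bs ℕ.+ sum (map (λ b → count (Q? b) as) bs)
      ≡⟨ cong (ℕ._+ _) (trans (count-as-sum (λ b → Q? b a) bs) (cong sum (Listₚ.map-cong transpose bs))) ⟩
    sum (map (λ b → count (Q? b) [ a ]) bs) ℕ.+ sum (map (λ b → count (Q? b) as) bs)
      ≡⟨ sum-map-+ (λ b → count (Q? b) [ a ]) (λ b → count (Q? b) as) bs ⟨
    sum (map (λ b → count (Q? b) [ a ] ℕ.+ count (Q? b) as) bs)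
      ≡⟨ cong sum (Listₚ.map-cong (λ b → count-++ (Q? b) [ a ] as) bs) ⟨
    sum (map (λ b → count (Q? b) (a ∷ as)) bs) ∎
    where
    open ≡-Reasoning
    fibre : count (λ b → Q? b a) bs ≡ count P? [ a ]
    fibre with P? a
    ... | yes pa = one pa
    ... | no ¬pa = none ¬pa
    transpose : ∀ b → count (λ b′ → Q? b′ a) [ b ] ≡ count (Q? b) [ a ]
    transpose b with Q? b a
    ... | yes _ = refl
    ... | no _ = refl

length-cartesianProductWith : {A B C : Set} (f : A → B → C) (xs : List A) {ys : List B} →
                              length (cartesianProductWith f xs ys) ≡ length xs ℕ.* length ys
length-cartesianProductWith f []       = refl
length-cartesianProductWith f (x ∷ xs) {ys} =
  trans (Listₚ.length-++ (map (f x) ys)) (cong₂ ℕ._+_ (Listₚ.length-map (f x) ys) (length-cartesianProductWith f xs))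

allVecs : {A : Set} (m : ℕ) → List A → List (Vec A m)
allVecs zero    _  = [ [] ]
allVecs (suc m) xs = cartesianProductWith _∷_ xs (allVecs m xs)

module _ {A : Set} where

  allVecs-unique : ∀ m {xs : List A} → Unique xs → Unique (allVecs m xs)
  allVecs-unique zero    xs! = [] AllPairs.∷ AllPairs.[]
  allVecs-unique (suc m) xs! = Uniqueₚ.cartesianProductWith⁺ _∷_ Vecₚ.∷-injective xs! (allVecs-unique m xs!)

  allVecs-complete : ∀ m {xs : List A} → (∀ x → x ∈ xs) → ∀ v → v ∈ allVecs m xs
  allVecs-complete zero    ∈xs []      = here refl
  allVecs-complete (suc m) ∈xs (x ∷ v) = ∈ₚ.∈-cartesianProductWith⁺ _∷_ (∈xs x) (allVecs-complete m ∈xs v)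

  length-allVecs : ∀ m (xs : List A) → length (allVecs m xs) ≡ length xs ℕ.^ m
  length-allVecs zero    xs = refl
  length-allVecs (suc m) xs = trans (length-cartesianProductWith _∷_ xs) (cong (length xs ℕ.*_) (length-allVecs m xs))

lookup-ext : {A : Set} {n : ℕ} (xs ys : Vec A n) → (∀ i → Vec.lookup xs i ≡ Vec.lookup ys i) → xs ≡ ys
lookup-ext xs ys e = trans (sym (Vecₚ.tabulate∘lookup xs)) (trans (Vecₚ.tabulate-cong e) (Vecₚ.tabulate∘lookup ys))

module _ {A : Set} where

  reindex : ∀ {m n} (v : Vec A m) → m ≡ n → Σ (Vec A n) (λ w → Vec.toList w ≡ Vec.toList v)
  reindex v refl = v , refl

  lookup²-tabulate² : ∀ {m n} (f : Fin m → Fin n → A) i j →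
                      Vec.lookup (Vec.lookup (Vec.tabulate (λ i → Vec.tabulate (f i))) i) j ≡ f i j
  lookup²-tabulate² f i j = trans (cong (λ v → Vec.lookup v j) (Vecₚ.lookup∘tabulate (λ i → Vec.tabulate (f i)) i))
                                  (Vecₚ.lookup∘tabulate (f i) j)

  rowsOf : ∀ {m n} → (Fin m → Fin n → A) → Vec (Vec A n) m
  rowsOf a = Vec.tabulate (λ i → Vec.tabulate (a i))

  columnsOf : ∀ {m n} → (Fin m → Fin n → A) → Vec (Vec A m) n
  columnsOf a = Vec.tabulate (λ j → Vec.tabulate (λ i → a i j))

  transposeᵥ : ∀ {m n} → Vec (Vec A n) m → Vec (Vec A m) n
  transposeᵥ R = columnsOf (λ i j → Vec.lookup (Vec.lookup R i) j)

  transposeᵥ-involutive : ∀ {m n} (R : Vec (Vec A n) m) → transposeᵥ (transposeᵥ R) ≡ R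
  transposeᵥ-involutive R = lookup-ext _ R λ i → lookup-ext _ _ λ j →
    trans (lookup²-tabulate² (λ i j → Vec.lookup (Vec.lookup (transposeᵥ R) j) i) i j)
          (lookup²-tabulate² (λ j i → Vec.lookup (Vec.lookup R i) j) j i)

  transposeᵥ-injective : ∀ {m n} {R R′ : Vec (Vec A n) m} → transposeᵥ R ≡ transposeᵥ R′ → R ≡ R′
  transposeᵥ-injective {R = R} {R′} e =
    trans (sym (transposeᵥ-involutive R)) (trans (cong transposeᵥ e) (transposeᵥ-involutive R′))

  columnsOf≡transposeᵥ∘rowsOf : ∀ {m n} (a : Fin m → Fin n → A) → columnsOf a ≡ transposeᵥ (rowsOf a)
  columnsOf≡transposeᵥ∘rowsOf a = Vecₚ.tabulate-cong λ j → Vecₚ.tabulate-cong λ i → sym (lookup²-tabulate² a i j)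

module PolynomialRing {q : ℕ} (𝔽 : FiniteField q) where
  open FiniteField 𝔽

  fieldRing : CommutativeRing 0ℓ 0ℓ
  fieldRing = record { isCommutativeRing = isCommutativeRing }

  module F = CommutativeRing fieldRing
  private module Fₚ = RingProperties F.ring
  open import Algebra.Solver.Ring.NaturalCoefficients F.commutativeSemiring (λ _ _ → nothing)
  open ≡-Reasoning

  x-y+y≡x : ∀ x y → x + - y + y ≡ x
  x-y+y≡x x y = Fₚ.//-rightDividesˡ y x

  infixr 8 _·ₚ_
  _·ₚ_ : F → Poly → Poly
  c ·ₚ p = map (c *_) p

  coeff : Poly → ℕ → F
  coeff []      _       = 0#
  coeff (a ∷ p) zero    = a
  coeff (a ∷ p) (suc t) = coeff p t

  -- A record rather than a function type, so that Agda can infer p and r.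
  infix 4 _≋_
  record _≋_ (p r : Poly) : Set where
    constructor mk≋
    field at : ∀ t → coeff p t ≡ coeff r t
  open _≋_ public

  ≋-refl : ∀ {p} → p ≋ p
  ≋-refl = mk≋ λ t → refl

  ≋-sym : ∀ {p r} → p ≋ r → r ≋ p
  ≋-sym e = mk≋ λ t → sym (at e t)

  ≋-trans : ∀ {p r s} → p ≋ r → r ≋ s → p ≋ s
  ≋-trans e f = mk≋ λ t → trans (at e t) (at f t)

  ≡⇒≋ : ∀ {p r} → p ≡ r → p ≋ r
  ≡⇒≋ refl = ≋-refl


  tailₚ : Poly → Poly
  tailₚ []      = []
  tailₚ (_ ∷ p) = p

  coeff-tailₚ : ∀ p t → coeff (tailₚ p) t ≡ coeff p (suc t)
  coeff-tailₚ []      t = refl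
  coeff-tailₚ (a ∷ p) t = refl

  coeff-+ : ∀ p r t → coeff (p +ₚ r) t ≡ coeff p t + coeff r t
  coeff-+ []      r       t       = sym (F.+-identityˡ _)
  coeff-+ (a ∷ p) []      t       = sym (F.+-identityʳ _)
  coeff-+ (a ∷ p) (b ∷ r) zero    = refl
  coeff-+ (a ∷ p) (b ∷ r) (suc t) = coeff-+ p r t

  coeff-· : ∀ c p t → coeff (c ·ₚ p) t ≡ c * coeff p t
  coeff-· c []      t       = sym (F.zeroʳ c)
  coeff-· c (a ∷ p) zero    = refl
  coeff-· c (a ∷ p) (suc t) = coeff-· c p t

  coeff-neg : ∀ p t → coeff (-ₚ p) t ≡ - coeff p t
  coeff-neg []      t       = sym Fₚ.-0#≈0#
  coeff-neg (a ∷ p) zero    = refl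
  coeff-neg (a ∷ p) (suc t) = coeff-neg p t

  coeff₀-*ₚ : ∀ p r → coeff (p *ₚ r) 0 ≡ coeff p 0 * coeff r 0
  coeff₀-*ₚ []      r = sym (F.zeroˡ _)
  coeff₀-*ₚ (a ∷ p) r = begin
    coeff (a ·ₚ r +ₚ (0# ∷ p *ₚ r)) 0  ≡⟨ coeff-+ (a ·ₚ r) _ 0 ⟩
    coeff (a ·ₚ r) 0 + 0#               ≡⟨ F.+-identityʳ _ ⟩
    coeff (a ·ₚ r) 0                    ≡⟨ coeff-· a r 0 ⟩
    a * coeff r 0                       ∎

  coeff-suc-*ₚ : ∀ p r t → coeff (p *ₚ r) (suc t) ≡ coeff p 0 * coeff r (suc t) + coeff (tailₚ p *ₚ r) t
  coeff-suc-*ₚ []      r t = sym (trans (cong (_+ 0#) (F.zeroˡ _)) (F.+-identityʳ _))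
  coeff-suc-*ₚ (a ∷ p) r t = begin
    coeff (a ·ₚ r +ₚ (0# ∷ p *ₚ r)) (suc t)  ≡⟨ coeff-+ (a ·ₚ r) _ (suc t) ⟩
    coeff (a ·ₚ r) (suc t) + coeff (p *ₚ r) t ≡⟨ cong (_+ coeff (p *ₚ r) t) (coeff-· a r (suc t)) ⟩
    a * coeff r (suc t) + coeff (p *ₚ r) t    ∎

  +ₚ-cong : ∀ {p p′ r r′} → p ≋ p′ → r ≋ r′ → p +ₚ r ≋ p′ +ₚ r′
  +ₚ-cong {p} {p′} {r} {r′} e f = mk≋ λ t → begin
    coeff (p +ₚ r) t          ≡⟨ coeff-+ p r t ⟩
    coeff p t + coeff r t     ≡⟨ cong₂ _+_ (at e t) (at f t) ⟩
    coeff p′ t + coeff r′ t   ≡⟨ coeff-+ p′ r′ t ⟨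
    coeff (p′ +ₚ r′) t        ∎

  -ₚ-cong : ∀ {p p′} → p ≋ p′ → -ₚ p ≋ -ₚ p′
  -ₚ-cong {p} {p′} e = mk≋ λ t → trans (coeff-neg p t) (trans (cong -_ (at e t)) (sym (coeff-neg p′ t)))

  tailₚ-cong : ∀ {p p′} → p ≋ p′ → tailₚ p ≋ tailₚ p′
  tailₚ-cong {p} {p′} e = mk≋ λ t → trans (coeff-tailₚ p t) (trans (at e (suc t)) (sym (coeff-tailₚ p′ t)))

  ∷-cong : ∀ {a b p r} → a ≡ b → p ≋ r → (a ∷ p) ≋ (b ∷ r)
  ∷-cong a≡b e = mk≋ λ { zero → a≡b ; (suc t) → at e t }

  coeff-*ₚ-congˡ : ∀ t r {p p′} → p ≋ p′ → coeff (p *ₚ r) t ≡ coeff (p′ *ₚ r) t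
  coeff-*ₚ-congˡ zero r {p} {p′} e =
    trans (coeff₀-*ₚ p r) (trans (cong (_* coeff r 0) (at e 0)) (sym (coeff₀-*ₚ p′ r)))
  coeff-*ₚ-congˡ (suc t) r {p} {p′} e = begin
    coeff (p *ₚ r) (suc t)                                  ≡⟨ coeff-suc-*ₚ p r t ⟩
    coeff p 0 * coeff r (suc t) + coeff (tailₚ p *ₚ r) t    ≡⟨ cong₂ _+_ (cong (_* coeff r (suc t)) (at e 0))
                                                                        (coeff-*ₚ-congˡ t r (tailₚ-cong e)) ⟩
    coeff p′ 0 * coeff r (suc t) + coeff (tailₚ p′ *ₚ r) t  ≡⟨ coeff-suc-*ₚ p′ r t ⟨
    coeff (p′ *ₚ r) (suc t)                                 ∎

  coeff-*ₚ-congʳ : ∀ t p {r r′} → r ≋ r′ → coeff (p *ₚ r) t ≡ coeff (p *ₚ r′) t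
  coeff-*ₚ-congʳ zero p {r} {r′} e =
    trans (coeff₀-*ₚ p r) (trans (cong (coeff p 0 *_) (at e 0)) (sym (coeff₀-*ₚ p r′)))
  coeff-*ₚ-congʳ (suc t) p {r} {r′} e = begin
    coeff (p *ₚ r) (suc t)                                  ≡⟨ coeff-suc-*ₚ p r t ⟩
    coeff p 0 * coeff r (suc t) + coeff (tailₚ p *ₚ r) t    ≡⟨ cong₂ _+_ (cong (coeff p 0 *_) (at e (suc t)))
                                                                        (coeff-*ₚ-congʳ t (tailₚ p) e) ⟩
    coeff p 0 * coeff r′ (suc t) + coeff (tailₚ p *ₚ r′) t  ≡⟨ coeff-suc-*ₚ p r′ t ⟨
    coeff (p *ₚ r′) (suc t)                                 ∎

  *ₚ-cong : ∀ {p p′ r r′} → p ≋ p′ → r ≋ r′ → p *ₚ r ≋ p′ *ₚ r′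
  *ₚ-cong {p′ = p′} {r} e f = mk≋ λ t → trans (coeff-*ₚ-congˡ t r e) (coeff-*ₚ-congʳ t p′ f)

  +ₚ-comm : ∀ p r → p +ₚ r ≋ r +ₚ p
  +ₚ-comm p r = mk≋ λ t → trans (coeff-+ p r t) (trans (F.+-comm _ _) (sym (coeff-+ r p t)))

  +ₚ-assoc : ∀ p r s → (p +ₚ r) +ₚ s ≋ p +ₚ (r +ₚ s)
  +ₚ-assoc p r s = mk≋ λ t → begin
    coeff ((p +ₚ r) +ₚ s) t              ≡⟨ coeff-+ (p +ₚ r) s t ⟩
    coeff (p +ₚ r) t + coeff s t         ≡⟨ cong (_+ coeff s t) (coeff-+ p r t) ⟩
    coeff p t + coeff r t + coeff s t    ≡⟨ F.+-assoc _ _ _ ⟩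
    coeff p t + (coeff r t + coeff s t)  ≡⟨ cong (coeff p t +_) (coeff-+ r s t) ⟨
    coeff p t + coeff (r +ₚ s) t         ≡⟨ coeff-+ p (r +ₚ s) t ⟨
    coeff (p +ₚ (r +ₚ s)) t              ∎

  +ₚ-identityˡ : ∀ p → [] +ₚ p ≋ p
  +ₚ-identityˡ p = ≋-refl

  +ₚ-identityʳ : ∀ p → p +ₚ [] ≋ p
  +ₚ-identityʳ []      = ≋-refl
  +ₚ-identityʳ (a ∷ p) = ≋-refl

  -ₚ‿inverseʳ : ∀ p → p +ₚ -ₚ p ≋ []
  -ₚ‿inverseʳ p = mk≋ λ t →
    trans (coeff-+ p (-ₚ p) t) (trans (cong (coeff p t +_) (coeff-neg p t)) (F.-‿inverseʳ _))

  -ₚ‿inverseˡ : ∀ p → -ₚ p +ₚ p ≋ []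
  -ₚ‿inverseˡ p = ≋-trans (+ₚ-comm (-ₚ p) p) (-ₚ‿inverseʳ p)

  coeff-*ₚ-zeroʳ : ∀ p t → coeff (p *ₚ []) t ≡ 0#
  coeff-*ₚ-zeroʳ p zero    = trans (coeff₀-*ₚ p []) (F.zeroʳ _)
  coeff-*ₚ-zeroʳ p (suc t) = begin
    coeff (p *ₚ []) (suc t)                  ≡⟨ coeff-suc-*ₚ p [] t ⟩
    coeff p 0 * 0# + coeff (tailₚ p *ₚ []) t ≡⟨ cong₂ _+_ (F.zeroʳ _) (coeff-*ₚ-zeroʳ (tailₚ p) t) ⟩
    0# + 0#                                  ≡⟨ F.+-identityʳ _ ⟩
    0#                                       ∎

  *ₚ-zeroʳ : ∀ p → p *ₚ [] ≋ []
  *ₚ-zeroʳ p = mk≋ (coeff-*ₚ-zeroʳ p)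

  *ₚ-identityˡ : ∀ p → (1# ∷ []) *ₚ p ≋ p
  *ₚ-identityˡ p = mk≋ λ
    { zero    → trans (coeff₀-*ₚ (1# ∷ []) p) (F.*-identityˡ _)
    ; (suc t) → trans (coeff-suc-*ₚ (1# ∷ []) p t) (trans (cong (_+ 0#) (F.*-identityˡ _)) (F.+-identityʳ _))
    }

  coeff-*ₚ-∷ : ∀ t r a p → coeff (r *ₚ (a ∷ p)) t ≡ coeff (a ·ₚ r +ₚ (0# ∷ r *ₚ p)) t
  coeff-*ₚ-∷ zero r a p = begin
    coeff (r *ₚ (a ∷ p)) 0                 ≡⟨ coeff₀-*ₚ r (a ∷ p) ⟩
    coeff r 0 * a                          ≡⟨ F.*-comm _ _ ⟩
    a * coeff r 0                          ≡⟨ coeff-· a r 0 ⟨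
    coeff (a ·ₚ r) 0                       ≡⟨ F.+-identityʳ _ ⟨
    coeff (a ·ₚ r) 0 + 0#                  ≡⟨ coeff-+ (a ·ₚ r) _ 0 ⟨
    coeff (a ·ₚ r +ₚ (0# ∷ r *ₚ p)) 0      ∎
  coeff-*ₚ-∷ (suc t) r a p = begin
    coeff (r *ₚ (a ∷ p)) (suc t)
      ≡⟨ coeff-suc-*ₚ r (a ∷ p) t ⟩
    r₀ * coeff (a ∷ p) (suc t) + coeff (tailₚ r *ₚ (a ∷ p)) t
      ≡⟨ cong (r₀ * coeff p t +_) (trans (coeff-*ₚ-∷ t (tailₚ r) a p) (coeff-+ (a ·ₚ tailₚ r) _ t)) ⟩
    r₀ * coeff p t + (coeff (a ·ₚ tailₚ r) t + coeff (0# ∷ tailₚ r *ₚ p) t)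
      ≡⟨ cong (λ z → r₀ * coeff p t + (z + coeff (0# ∷ tailₚ r *ₚ p) t))
              (trans (coeff-· a (tailₚ r) t) (cong (a *_) (coeff-tailₚ r t))) ⟩
    r₀ * coeff p t + (a * coeff r (suc t) + coeff (0# ∷ tailₚ r *ₚ p) t)
      ≡⟨ solve 3 (λ x y z → x :+ (y :+ z) := y :+ (z :+ x)) refl (r₀ * coeff p t) (a * coeff r (suc t)) _ ⟩
    a * coeff r (suc t) + (coeff (0# ∷ tailₚ r *ₚ p) t + r₀ * coeff p t)
      ≡⟨ cong₂ _+_ (coeff-· a r (suc t)) (shifted t) ⟨
    coeff (a ·ₚ r) (suc t) + coeff (r *ₚ p) t
      ≡⟨ coeff-+ (a ·ₚ r) _ (suc t) ⟨
    coeff (a ·ₚ r +ₚ (0# ∷ r *ₚ p)) (suc t) ∎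
    where
    r₀ = coeff r 0
    shifted : ∀ t → coeff (r *ₚ p) t ≡ coeff (0# ∷ tailₚ r *ₚ p) t + r₀ * coeff p t
    shifted zero    = trans (coeff₀-*ₚ r p) (sym (F.+-identityˡ _))
    shifted (suc t) = trans (coeff-suc-*ₚ r p t) (F.+-comm _ _)

  *ₚ-comm : ∀ p r → p *ₚ r ≋ r *ₚ p
  *ₚ-comm []      r = ≋-sym (*ₚ-zeroʳ r)
  *ₚ-comm (a ∷ p) r =
    ≋-trans (+ₚ-cong (≋-refl {a ·ₚ r}) (∷-cong refl (*ₚ-comm p r))) (mk≋ λ t → sym (coeff-*ₚ-∷ t r a p))

  coeff-*ₚ-distribˡ : ∀ t p r r′ → coeff (p *ₚ (r +ₚ r′)) t ≡ coeff (p *ₚ r +ₚ p *ₚ r′) t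
  coeff-*ₚ-distribˡ zero p r r′ = begin
    coeff (p *ₚ (r +ₚ r′)) 0                          ≡⟨ coeff₀-*ₚ p _ ⟩
    coeff p 0 * coeff (r +ₚ r′) 0                     ≡⟨ cong (coeff p 0 *_) (coeff-+ r r′ 0) ⟩
    coeff p 0 * (coeff r 0 + coeff r′ 0)              ≡⟨ F.distribˡ _ _ _ ⟩
    coeff p 0 * coeff r 0 + coeff p 0 * coeff r′ 0    ≡⟨ cong₂ _+_ (coeff₀-*ₚ p r) (coeff₀-*ₚ p r′) ⟨
    coeff (p *ₚ r) 0 + coeff (p *ₚ r′) 0              ≡⟨ coeff-+ (p *ₚ r) _ 0 ⟨
    coeff (p *ₚ r +ₚ p *ₚ r′) 0                       ∎
  coeff-*ₚ-distribˡ (suc t) p r r′ = begin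
    coeff (p *ₚ (r +ₚ r′)) (suc t)
      ≡⟨ coeff-suc-*ₚ p _ t ⟩
    p₀ * coeff (r +ₚ r′) (suc t) + coeff (tailₚ p *ₚ (r +ₚ r′)) t
      ≡⟨ cong₂ _+_ (cong (p₀ *_) (coeff-+ r r′ (suc t)))
                   (trans (coeff-*ₚ-distribˡ t (tailₚ p) r r′) (coeff-+ (tailₚ p *ₚ r) _ t)) ⟩
    p₀ * (coeff r (suc t) + coeff r′ (suc t)) + (coeff (tailₚ p *ₚ r) t + coeff (tailₚ p *ₚ r′) t)
      ≡⟨ solve 5 (λ x y z u v → x :* (y :+ z) :+ (u :+ v) := (x :* y :+ u) :+ (x :* z :+ v)) refl _ _ _ _ _ ⟩
    (p₀ * coeff r (suc t) + coeff (tailₚ p *ₚ r) t) + (p₀ * coeff r′ (suc t) + coeff (tailₚ p *ₚ r′) t)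
      ≡⟨ cong₂ _+_ (coeff-suc-*ₚ p r t) (coeff-suc-*ₚ p r′ t) ⟨
    coeff (p *ₚ r) (suc t) + coeff (p *ₚ r′) (suc t)
      ≡⟨ coeff-+ (p *ₚ r) _ (suc t) ⟨
    coeff (p *ₚ r +ₚ p *ₚ r′) (suc t) ∎
    where p₀ = coeff p 0

  *ₚ-distribˡ : ∀ p r r′ → p *ₚ (r +ₚ r′) ≋ p *ₚ r +ₚ p *ₚ r′
  *ₚ-distribˡ p r r′ = mk≋ λ t → coeff-*ₚ-distribˡ t p r r′

  *ₚ-distribʳ : ∀ p r r′ → (r +ₚ r′) *ₚ p ≋ r *ₚ p +ₚ r′ *ₚ p
  *ₚ-distribʳ p r r′ =
    ≋-trans (*ₚ-comm (r +ₚ r′) p) (≋-trans (*ₚ-distribˡ p r r′) (+ₚ-cong (*ₚ-comm p r) (*ₚ-comm p r′)))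

  tailₚ-· : ∀ c p → tailₚ (c ·ₚ p) ≋ c ·ₚ tailₚ p
  tailₚ-· c []      = ≋-refl
  tailₚ-· c (a ∷ p) = ≋-refl

  coeff-·-*ₚ : ∀ t c p r → coeff (c ·ₚ p *ₚ r) t ≡ c * coeff (p *ₚ r) t
  coeff-·-*ₚ zero c p r = begin
    coeff (c ·ₚ p *ₚ r) 0           ≡⟨ coeff₀-*ₚ (c ·ₚ p) r ⟩
    coeff (c ·ₚ p) 0 * coeff r 0    ≡⟨ cong (_* coeff r 0) (coeff-· c p 0) ⟩
    c * coeff p 0 * coeff r 0       ≡⟨ F.*-assoc _ _ _ ⟩
    c * (coeff p 0 * coeff r 0)     ≡⟨ cong (c *_) (coeff₀-*ₚ p r) ⟨
    c * coeff (p *ₚ r) 0            ∎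
  coeff-·-*ₚ (suc t) c p r = begin
    coeff (c ·ₚ p *ₚ r) (suc t)
      ≡⟨ coeff-suc-*ₚ (c ·ₚ p) r t ⟩
    coeff (c ·ₚ p) 0 * coeff r (suc t) + coeff (tailₚ (c ·ₚ p) *ₚ r) t
      ≡⟨ cong₂ _+_ (cong (_* coeff r (suc t)) (coeff-· c p 0))
                   (trans (coeff-*ₚ-congˡ t r (tailₚ-· c p)) (coeff-·-*ₚ t c (tailₚ p) r)) ⟩
    c * coeff p 0 * coeff r (suc t) + c * coeff (tailₚ p *ₚ r) t
      ≡⟨ solve 4 (λ x y z w → x :* y :* z :+ x :* w := x :* (y :* z :+ w)) refl _ _ _ _ ⟩
    c * (coeff p 0 * coeff r (suc t) + coeff (tailₚ p *ₚ r) t)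
      ≡⟨ cong (c *_) (coeff-suc-*ₚ p r t) ⟨
    c * coeff (p *ₚ r) (suc t) ∎

  tailₚ-*ₚ : ∀ p r → tailₚ (p *ₚ r) ≋ coeff p 0 ·ₚ tailₚ r +ₚ tailₚ p *ₚ r
  tailₚ-*ₚ p r = mk≋ λ t → begin
    coeff (tailₚ (p *ₚ r)) t                                   ≡⟨ coeff-tailₚ (p *ₚ r) t ⟩
    coeff (p *ₚ r) (suc t)                                     ≡⟨ coeff-suc-*ₚ p r t ⟩
    coeff p 0 * coeff r (suc t) + coeff (tailₚ p *ₚ r) t       ≡⟨ cong (λ z → coeff p 0 * z + coeff (tailₚ p *ₚ r) t) (coeff-tailₚ r t) ⟨
    coeff p 0 * coeff (tailₚ r) t + coeff (tailₚ p *ₚ r) t     ≡⟨ cong (_+ coeff (tailₚ p *ₚ r) t) (coeff-· _ (tailₚ r) t) ⟨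
    coeff (coeff p 0 ·ₚ tailₚ r) t + coeff (tailₚ p *ₚ r) t    ≡⟨ coeff-+ (coeff p 0 ·ₚ tailₚ r) _ t ⟨
    coeff (coeff p 0 ·ₚ tailₚ r +ₚ tailₚ p *ₚ r) t             ∎

  coeff-*ₚ-assoc : ∀ t p r s → coeff ((p *ₚ r) *ₚ s) t ≡ coeff (p *ₚ (r *ₚ s)) t
  coeff-*ₚ-assoc zero p r s = begin
    coeff ((p *ₚ r) *ₚ s) 0              ≡⟨ coeff₀-*ₚ (p *ₚ r) s ⟩
    coeff (p *ₚ r) 0 * coeff s 0         ≡⟨ cong (_* coeff s 0) (coeff₀-*ₚ p r) ⟩
    coeff p 0 * coeff r 0 * coeff s 0    ≡⟨ F.*-assoc _ _ _ ⟩
    coeff p 0 * (coeff r 0 * coeff s 0)  ≡⟨ cong (coeff p 0 *_) (coeff₀-*ₚ r s) ⟨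
    coeff p 0 * coeff (r *ₚ s) 0         ≡⟨ coeff₀-*ₚ p (r *ₚ s) ⟨
    coeff (p *ₚ (r *ₚ s)) 0              ∎
  coeff-*ₚ-assoc (suc t) p r s = begin
    coeff ((p *ₚ r) *ₚ s) (suc t)
      ≡⟨ coeff-suc-*ₚ (p *ₚ r) s t ⟩
    coeff (p *ₚ r) 0 * coeff s (suc t) + coeff (tailₚ (p *ₚ r) *ₚ s) t
      ≡⟨ cong₂ _+_ (cong (_* coeff s (suc t)) (coeff₀-*ₚ p r)) (coeff-*ₚ-congˡ t s (tailₚ-*ₚ p r)) ⟩
    p₀ * r₀ * coeff s (suc t) + coeff ((p₀ ·ₚ tailₚ r +ₚ tailₚ p *ₚ r) *ₚ s) t
      ≡⟨ cong (p₀ * r₀ * coeff s (suc t) +_)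
              (trans (at (*ₚ-distribʳ s (p₀ ·ₚ tailₚ r) (tailₚ p *ₚ r)) t) (coeff-+ (p₀ ·ₚ tailₚ r *ₚ s) _ t)) ⟩
    p₀ * r₀ * coeff s (suc t) + (coeff (p₀ ·ₚ tailₚ r *ₚ s) t + coeff ((tailₚ p *ₚ r) *ₚ s) t)
      ≡⟨ cong (p₀ * r₀ * coeff s (suc t) +_) (cong₂ _+_ (coeff-·-*ₚ t p₀ (tailₚ r) s) (coeff-*ₚ-assoc t (tailₚ p) r s)) ⟩
    p₀ * r₀ * coeff s (suc t) + (p₀ * coeff (tailₚ r *ₚ s) t + coeff (tailₚ p *ₚ (r *ₚ s)) t)
      ≡⟨ solve 5 (λ a b c d e → a :* b :* c :+ (a :* d :+ e) := a :* (b :* c :+ d) :+ e) refl _ _ _ _ _ ⟩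
    p₀ * (r₀ * coeff s (suc t) + coeff (tailₚ r *ₚ s) t) + coeff (tailₚ p *ₚ (r *ₚ s)) t
      ≡⟨ cong (λ z → p₀ * z + coeff (tailₚ p *ₚ (r *ₚ s)) t) (coeff-suc-*ₚ r s t) ⟨
    p₀ * coeff (r *ₚ s) (suc t) + coeff (tailₚ p *ₚ (r *ₚ s)) t
      ≡⟨ coeff-suc-*ₚ p (r *ₚ s) t ⟨
    coeff (p *ₚ (r *ₚ s)) (suc t) ∎
    where
    p₀ = coeff p 0
    r₀ = coeff r 0

  *ₚ-assoc : ∀ p r s → (p *ₚ r) *ₚ s ≋ p *ₚ (r *ₚ s)
  *ₚ-assoc p r s = mk≋ λ t → coeff-*ₚ-assoc t p r s

  *ₚ-identityʳ : ∀ p → p *ₚ (1# ∷ []) ≋ p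
  *ₚ-identityʳ p = ≋-trans (*ₚ-comm p _) (*ₚ-identityˡ p)

  polyRing : CommutativeRing 0ℓ 0ℓ
  polyRing = record
    { Carrier = Poly ; _≈_ = _≋_ ; _+_ = _+ₚ_ ; _*_ = _*ₚ_ ; -_ = -ₚ_ ; 0# = [] ; 1# = 1# ∷ []
    ; isCommutativeRing = record
      { isRing = record
        { +-isAbelianGroup = record
          { isGroup = record
            { isMonoid = record
              { isSemigroup = record
                { isMagma = record
                  { isEquivalence = record { refl = ≋-refl ; sym = ≋-sym ; trans = ≋-trans }
                  ; ∙-cong = +ₚ-cong
                  }
                ; assoc = +ₚ-assoc
                }
              ; identity = +ₚ-identityˡ , +ₚ-identityʳ
              }
            ; inverse = -ₚ‿inverseˡ , -ₚ‿inverseʳ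
            ; ⁻¹-cong = -ₚ-cong
            }
          ; comm = +ₚ-comm
          }
        ; *-cong = *ₚ-cong
        ; *-assoc = *ₚ-assoc
        ; *-identity = *ₚ-identityˡ , *ₚ-identityʳ
        ; distrib = *ₚ-distribˡ , *ₚ-distribʳ
        }
      ; *-comm = *ₚ-comm
      }
    }

module MonicGcd {q : ℕ} (𝔽 : FiniteField q) where
  open FiniteField 𝔽
  open PolynomialRing 𝔽

  module P = CommutativeRing polyRing
  module Pₚ = RingProperties P.ring
  open import Algebra.Solver.Ring.NaturalCoefficients P.commutativeSemiring (λ _ _ → nothing) renaming (solve to psolve)
  import Relation.Binary.Reasoning.Setoid P.setoid as SR

  constₚ : F → Poly
  constₚ c = c ∷ []

  record DegreeBelow (p : Poly) (b : ℕ) : Set where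
    constructor mkDegreeBelow
    field vanish : ∀ s → b ℕ.≤ s → coeff p s ≡ 0#
  open DegreeBelow public

  degreeBelow-length : ∀ p → DegreeBelow p (length p)
  degreeBelow-length []      = mkDegreeBelow λ _ _ → refl
  degreeBelow-length (a ∷ p) = mkDegreeBelow λ { (suc s) (s≤s le) → vanish (degreeBelow-length p) s le }

  degreeBelow-mono : ∀ {p a b} → a ℕ.≤ b → DegreeBelow p a → DegreeBelow p b
  degreeBelow-mono a≤b B = mkDegreeBelow λ s b≤s → vanish B s (ℕₚ.≤-trans a≤b b≤s)

  degreeBelow-pred : ∀ {p n} → DegreeBelow p (suc n) → coeff p n ≡ 0# → DegreeBelow p n
  degreeBelow-pred B pₙ≡0 = mkDegreeBelow λ s n≤s → case ℕₚ.m≤n⇒m<n∨m≡n n≤s of λ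
    { (inj₁ n<s)  → vanish B s n<s
    ; (inj₂ refl) → pₙ≡0
    }

  degreeBelow-zero : ∀ {p} → DegreeBelow p 0 → p ≋ []
  degreeBelow-zero B = mk≋ λ t → vanish B t z≤n

  degreeBelow-cong : ∀ {p p′ b} → p ≋ p′ → DegreeBelow p b → DegreeBelow p′ b
  degreeBelow-cong e B = mkDegreeBelow λ s b≤s → trans (sym (at e s)) (vanish B s b≤s)

  degreeBelow-tailₚ : ∀ {p a} → DegreeBelow p (suc a) → DegreeBelow (tailₚ p) a
  degreeBelow-tailₚ {p} B = mkDegreeBelow λ s a≤s → trans (coeff-tailₚ p s) (vanish B (suc s) (s≤s a≤s))

  coeff-*ₚ-zeroˡ : ∀ {p} h t → p ≋ [] → coeff (p *ₚ h) t ≡ 0#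
  coeff-*ₚ-zeroˡ h t p≋[] = coeff-*ₚ-congˡ t h p≋[]

  x*0+0≡0 : ∀ x → x * 0# + 0# ≡ 0#
  x*0+0≡0 x = trans (F.+-identityʳ _) (F.zeroʳ x)

  degreeBelow-*ₚ : ∀ a {b} m h → DegreeBelow m (suc a) → DegreeBelow h b → DegreeBelow (m *ₚ h) (a ℕ.+ b)
  degreeBelow-*ₚ a {b} m h Bm Bh = mkDegreeBelow (vanish-*ₚ a m Bm)
    where
    suc-vanishes : ∀ m s → b ℕ.≤ suc s → coeff (tailₚ m *ₚ h) s ≡ 0# → coeff (m *ₚ h) (suc s) ≡ 0#
    suc-vanishes m s b≤1+s tail≡0 = begin
      coeff (m *ₚ h) (suc s)                                ≡⟨ coeff-suc-*ₚ m h s ⟩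
      coeff m 0 * coeff h (suc s) + coeff (tailₚ m *ₚ h) s  ≡⟨ cong₂ _+_ (cong (coeff m 0 *_) (vanish Bh (suc s) b≤1+s)) tail≡0 ⟩
      coeff m 0 * 0# + 0#                                   ≡⟨ x*0+0≡0 _ ⟩
      0#                                                    ∎
      where open ≡-Reasoning
    vanish-*ₚ : ∀ a m → DegreeBelow m (suc a) → ∀ s → a ℕ.+ b ℕ.≤ s → coeff (m *ₚ h) s ≡ 0#
    vanish-*ₚ a m Bm zero a+b≤0 = begin
      coeff (m *ₚ h) 0           ≡⟨ coeff₀-*ₚ m h ⟩
      coeff m 0 * coeff h 0      ≡⟨ cong (coeff m 0 *_) (vanish Bh 0 (ℕₚ.m+n≤o⇒n≤o a a+b≤0)) ⟩
      coeff m 0 * 0#             ≡⟨ F.zeroʳ _ ⟩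
      0#                         ∎
      where open ≡-Reasoning
    vanish-*ₚ zero    m Bm (suc s) b≤1+s =
      suc-vanishes m s b≤1+s (coeff-*ₚ-zeroˡ h s (degreeBelow-zero (degreeBelow-tailₚ {m} Bm)))
    vanish-*ₚ (suc a) m Bm (suc s) a+b<1+s =
      suc-vanishes m s (ℕₚ.m+n≤o⇒n≤o (suc a) a+b<1+s)
        (vanish-*ₚ a (tailₚ m) (degreeBelow-tailₚ {m} Bm) s (ℕₚ.≤-pred a+b<1+s))

  coeff-*ₚ-leading : ∀ a b m h → DegreeBelow m (suc a) → DegreeBelow h (suc b) →
                     coeff (m *ₚ h) (a ℕ.+ b) ≡ coeff m a * coeff h b
  coeff-*ₚ-leading zero zero m h _ _ = coeff₀-*ₚ m h
  coeff-*ₚ-leading zero (suc b) m h Bm Bh = begin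
    coeff (m *ₚ h) (suc b)                                ≡⟨ coeff-suc-*ₚ m h b ⟩
    coeff m 0 * coeff h (suc b) + coeff (tailₚ m *ₚ h) b  ≡⟨ cong (coeff m 0 * coeff h (suc b) +_) tail≡0 ⟩
    coeff m 0 * coeff h (suc b) + 0#                      ≡⟨ F.+-identityʳ _ ⟩
    coeff m 0 * coeff h (suc b)                           ∎
    where
    open ≡-Reasoning
    tail≡0 = coeff-*ₚ-zeroˡ h b (degreeBelow-zero (degreeBelow-tailₚ {m} Bm))
  coeff-*ₚ-leading (suc a) b m h Bm Bh = begin
    coeff (m *ₚ h) (suc (a ℕ.+ b))
      ≡⟨ coeff-suc-*ₚ m h (a ℕ.+ b) ⟩
    coeff m 0 * coeff h (suc (a ℕ.+ b)) + coeff (tailₚ m *ₚ h) (a ℕ.+ b)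
      ≡⟨ cong₂ _+_ (cong (coeff m 0 *_) (vanish Bh (suc (a ℕ.+ b)) (s≤s (ℕₚ.m≤n+m b a))))
                   (coeff-*ₚ-leading a b (tailₚ m) h (degreeBelow-tailₚ {m} Bm) Bh) ⟩
    coeff m 0 * 0# + coeff (tailₚ m) a * coeff h b
      ≡⟨ cong (_+ coeff (tailₚ m) a * coeff h b) (F.zeroʳ _) ⟩
    0# + coeff (tailₚ m) a * coeff h b
      ≡⟨ trans (F.+-identityˡ _) (cong (_* coeff h b) (coeff-tailₚ m a)) ⟩
    coeff m (suc a) * coeff h b ∎
    where open ≡-Reasoning

  IsMonic : Poly → ℕ → Set
  IsMonic m e = DegreeBelow m (suc e) × coeff m e ≡ 1#

  -- The top coefficient h_n of h reappears as the coefficient (m h)_{e+n}.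
  degreeBelow-cancel-monic : ∀ {e t} m h → IsMonic m e → DegreeBelow (m *ₚ h) (e ℕ.+ t) → DegreeBelow h t
  degreeBelow-cancel-monic {e} {t} m h (Bm , mₑ≡1) Bmh =
    lower (length h) (degreeBelow-mono (ℕₚ.m≤n+m (length h) t) (degreeBelow-length h))
    where
    lower : ∀ u → DegreeBelow h (t ℕ.+ u) → DegreeBelow h t
    lower zero    Bh = subst (DegreeBelow h) (ℕₚ.+-identityʳ t) Bh
    lower (suc u) Bh = lower u (degreeBelow-pred Bh′ (begin
      coeff h (t ℕ.+ u)                 ≡⟨ F.*-identityˡ _ ⟨
      1# * coeff h (t ℕ.+ u)            ≡⟨ cong (_* coeff h (t ℕ.+ u)) mₑ≡1 ⟨
      coeff m e * coeff h (t ℕ.+ u)     ≡⟨ coeff-*ₚ-leading e (t ℕ.+ u) m h Bm Bh′ ⟨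
      coeff (m *ₚ h) (e ℕ.+ (t ℕ.+ u))  ≡⟨ vanish Bmh _ (ℕₚ.+-monoʳ-≤ e (ℕₚ.m≤m+n t u)) ⟩
      0#                                ∎))
      where
      open ≡-Reasoning
      Bh′ : DegreeBelow h (suc (t ℕ.+ u))
      Bh′ = subst (DegreeBelow h) (ℕₚ.+-suc t u) Bh

  monic-*ₚ : ∀ {e e′ m m′} → IsMonic m e → IsMonic m′ e′ → IsMonic (m *ₚ m′) (e ℕ.+ e′)
  monic-*ₚ {e} {e′} {m} {m′} (Bm , mₑ≡1) (Bm′ , m′ₑ′≡1) =
    subst (DegreeBelow (m *ₚ m′)) (ℕₚ.+-suc e e′) (degreeBelow-*ₚ e m m′ Bm Bm′) ,
    trans (coeff-*ₚ-leading e e′ m m′ Bm Bm′) (trans (cong₂ _*_ mₑ≡1 m′ₑ′≡1) (F.*-identityˡ _))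

  monic : ∀ {e} → Vec F e → Poly
  monic β = Vec.toList β ++ [ 1# ]

  monic-isMonic : ∀ {e} (β : Vec F e) → IsMonic (monic β) e
  monic-isMonic []      = degreeBelow-length [ 1# ] , refl
  monic-isMonic (x ∷ β) = mkDegreeBelow (λ { (suc s) (s≤s e≤s) → vanish (proj₁ (monic-isMonic β)) s e≤s }) ,
                          proj₂ (monic-isMonic β)

  monic-injective : ∀ {e} (β β′ : Vec F e) → monic β ≋ monic β′ → β ≡ β′
  monic-injective []      []        _ = refl
  monic-injective (x ∷ β) (x′ ∷ β′) e = cong₂ _∷_ (at e 0) (monic-injective β β′ (tailₚ-cong e))

  infix 4 _∣_
  record _∣_ (g p : Poly) : Set where
    constructor divides
    field
      quotient : Poly
      g*quotient≋p : g *ₚ quotient ≋ p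

  ∣-refl : ∀ {g} → g ∣ g
  ∣-refl {g} = divides (constₚ 1#) (*ₚ-identityʳ g)

  ∣-trans : ∀ {g h p} → g ∣ h → h ∣ p → g ∣ p
  ∣-trans {g} (divides x gx≋h) (divides y hy≋p) =
    divides (x *ₚ y) (≋-trans (≋-sym (*ₚ-assoc g x y)) (≋-trans (P.*-congʳ gx≋h) hy≋p))

  ∣-respʳ : ∀ {g p p′} → p ≋ p′ → g ∣ p → g ∣ p′
  ∣-respʳ e (divides x gx≋p) = divides x (≋-trans gx≋p e)

  ∣-+ₚ : ∀ {g x y} → g ∣ x → g ∣ y → g ∣ x +ₚ y
  ∣-+ₚ {g} (divides a ga≋x) (divides b gb≋y) = divides (a +ₚ b) (≋-trans (*ₚ-distribˡ g a b) (+ₚ-cong ga≋x gb≋y))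

  ∣-*ₚˡ : ∀ {g x} y → g ∣ x → g ∣ y *ₚ x
  ∣-*ₚˡ {g} y (divides a ga≋x) =
    divides (y *ₚ a) (≋-trans (psolve 3 (λ g y a → g :* (y :* a) := y :* (g :* a)) ≋-refl g y a) (P.*-congˡ {y} ga≋x))

  ∣-*ₚʳ : ∀ {g x} y → g ∣ x → g ∣ x *ₚ y
  ∣-*ₚʳ {g} {x} y g∣x = ∣-respʳ (*ₚ-comm y x) (∣-*ₚˡ {g} y g∣x)

  ∣-*ₚ-cong : ∀ {g x} M → g ∣ x → M *ₚ g ∣ M *ₚ x
  ∣-*ₚ-cong {g} M (divides h gh≋x) = divides h (≋-trans (*ₚ-assoc M g h) (P.*-congˡ {M} gh≋x))

  ∣-[] : ∀ {g} → g ∣ []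
  ∣-[] {g} = divides [] (*ₚ-zeroʳ g)

  [0#]≋[] : [ 0# ] ≋ []
  [0#]≋[] = mk≋ λ { zero → refl ; (suc t) → refl }

  allZero⇒≋[] : ∀ {p} → All (_≡ 0#) p → p ≋ []
  allZero⇒≋[] []          = ≋-refl
  allZero⇒≋[] (x≡0 ∷ p≡0) = ≋-trans (∷-cong x≡0 (allZero⇒≋[] p≡0)) [0#]≋[]

  ≋[]⇒allZero : ∀ p → p ≋ [] → All (_≡ 0#) p
  ≋[]⇒allZero []      _ = []
  ≋[]⇒allZero (x ∷ p) e = at e 0 ∷ ≋[]⇒allZero p (tailₚ-cong e)

  ∣ₚ⇒∣ : ∀ {g p} → g ∣ₚ p → g ∣ p
  ∣ₚ⇒∣ {g} {p} (h , gh≈p) = divides h (Pₚ.x∙y⁻¹≈ε⇒x≈y (g *ₚ h) p (allZero⇒≋[] gh≈p))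

  ∣⇒∣ₚ : ∀ {g p} → g ∣ p → g ∣ₚ p
  ∣⇒∣ₚ (divides h gh≋p) = h , ≋[]⇒allZero _ (Pₚ.x≈y⇒x∙y⁻¹≈ε gh≋p)

  shift : Poly → Poly
  shift p = 0# ∷ p

  ∷≋shift+constₚ : ∀ a p → (a ∷ p) ≋ shift p +ₚ constₚ a
  ∷≋shift+constₚ a p = ∷-cong (sym (F.+-identityˡ a)) (≋-sym (+ₚ-identityʳ p))

  shift-+ₚ : ∀ p r → shift (p +ₚ r) ≋ shift p +ₚ shift r
  shift-+ₚ p r = ∷-cong (sym (F.+-identityˡ 0#)) ≋-refl

  *ₚ-∷ : ∀ r a p → r *ₚ (a ∷ p) ≋ a ·ₚ r +ₚ shift (r *ₚ p)
  *ₚ-∷ r a p = mk≋ λ t → coeff-*ₚ-∷ t r a p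

  constₚ-*ₚ : ∀ c p → constₚ c *ₚ p ≋ c ·ₚ p
  constₚ-*ₚ c p = ≋-trans (P.+-congˡ [0#]≋[]) (+ₚ-identityʳ _)

  replicate-0#≋[] : ∀ n → Vec.toList (Vec.replicate n 0#) ≋ []
  replicate-0#≋[] zero    = ≋-refl
  replicate-0#≋[] (suc n) = ≋-trans (∷-cong refl (replicate-0#≋[] n)) [0#]≋[]

  shiftIn : ∀ {e} → F → Vec F e → Vec F e × F
  shiftIn a []      = [] , a
  shiftIn a (x ∷ r) = let w , c = shiftIn x r in a ∷ w , c

  shiftIn-correct : ∀ {e} a (r : Vec F e) → let w , c = shiftIn a r in Vec.toList w ++ [ c ] ≡ a ∷ Vec.toList r
  shiftIn-correct a []      = refl
  shiftIn-correct a (x ∷ r) = cong (a ∷_) (shiftIn-correct x r)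

  subtractMultiple : ∀ {e} → F → Vec F e → Vec F e → Vec F e
  subtractMultiple c []      []      = []
  subtractMultiple c (x ∷ w) (b ∷ β) = (x + - (c * b)) ∷ subtractMultiple c w β

  ∷ʳ≋subtractMultiple+· : ∀ {e} c (w β : Vec F e) → Vec.toList w ++ [ c ] ≋ Vec.toList (subtractMultiple c w β) +ₚ c ·ₚ monic β
  ∷ʳ≋subtractMultiple+· c []      []      = ∷-cong (sym (F.*-identityʳ c)) ≋-refl
  ∷ʳ≋subtractMultiple+· c (x ∷ w) (b ∷ β) = ∷-cong (sym (x-y+y≡x x (c * b))) (∷ʳ≋subtractMultiple+· c w β)

  -- Long division from the top: prepending a to the remainder r′ of the tail overflows into y^e
  -- by one coefficient c, which is removed by subtracting c · monic β and becomes the next quotient digit.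
  divMonic : ∀ {e} → Vec F e → Poly → Poly × Vec F e
  divMonic {e} β []       = [] , Vec.replicate e 0#
  divMonic     β (a ∷ a′) = let q′ , r′ = divMonic β a′ ; w , c = shiftIn a r′ in (c ∷ q′) , subtractMultiple c w β

  divMonic-correct : ∀ {e} (β : Vec F e) a → let q , r = divMonic β a in a ≋ monic β *ₚ q +ₚ Vec.toList r
  divMonic-correct {e} β [] = ≋-sym (+ₚ-cong (*ₚ-zeroʳ (monic β)) (replicate-0#≋[] e))
  divMonic-correct β (a ∷ a′) = begin
    a ∷ a′                                                  ≈⟨ ∷≋shift+constₚ a a′ ⟩
    shift a′ +ₚ constₚ a                                    ≈⟨ P.+-congʳ {constₚ a} (∷-cong refl (divMonic-correct β a′)) ⟩
    shift (M *ₚ q′ +ₚ Vec.toList r′) +ₚ constₚ a            ≈⟨ P.+-congʳ {constₚ a} (shift-+ₚ (M *ₚ q′) (Vec.toList r′)) ⟩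
    (shift (M *ₚ q′) +ₚ shift (Vec.toList r′)) +ₚ constₚ a  ≈⟨ +ₚ-assoc (shift (M *ₚ q′)) (shift (Vec.toList r′)) (constₚ a) ⟩
    shift (M *ₚ q′) +ₚ (shift (Vec.toList r′) +ₚ constₚ a)  ≈⟨ P.+-congˡ {shift (M *ₚ q′)} (∷≋shift+constₚ a (Vec.toList r′)) ⟨
    shift (M *ₚ q′) +ₚ (a ∷ Vec.toList r′)                  ≡⟨ cong (shift (M *ₚ q′) +ₚ_) (shiftIn-correct a r′) ⟨
    shift (M *ₚ q′) +ₚ (Vec.toList w ++ [ c ])              ≈⟨ P.+-congˡ (∷ʳ≋subtractMultiple+· c w β) ⟩
    shift (M *ₚ q′) +ₚ (Vec.toList r +ₚ c ·ₚ M)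
      ≈⟨ psolve 3 (λ x y z → x :+ (y :+ z) := (z :+ x) :+ y) ≋-refl (shift (M *ₚ q′)) (Vec.toList r) (c ·ₚ M) ⟩
    (c ·ₚ M +ₚ shift (M *ₚ q′)) +ₚ Vec.toList r             ≈⟨ P.+-congʳ (*ₚ-∷ M c q′) ⟨
    M *ₚ (c ∷ q′) +ₚ Vec.toList r                           ∎
    where
    open SR
    M = monic β
    q′ = proj₁ (divMonic β a′)
    r′ = proj₂ (divMonic β a′)
    w = proj₁ (shiftIn a r′)
    c = proj₂ (shiftIn a r′)
    r = subtractMultiple c w β

  LeadingTerm : ∀ {e} → Vec F e → Set
  LeadingTerm {e} r = Σ[ e′ ∈ ℕ ] e′ ℕ.< e × Σ[ w ∈ Vec F e′ ] Σ[ ℓ ∈ F ] ℓ ≢ 0# × Vec.toList r ≋ Vec.toList w ++ [ ℓ ]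

  zero⊎leadingTerm : ∀ {e} (r : Vec F e) → Vec.toList r ≋ [] ⊎ LeadingTerm r
  zero⊎leadingTerm [] = inj₁ ≋-refl
  zero⊎leadingTerm (x ∷ r) with zero⊎leadingTerm r
  ... | inj₂ (e′ , e′<e , w , ℓ , ℓ≢0 , r≋) = inj₂ (suc e′ , s≤s e′<e , x ∷ w , ℓ , ℓ≢0 , ∷-cong refl r≋)
  ... | inj₁ r≋[] with x ≟ 0#
  ...   | yes x≡0 = inj₁ (≋-trans (∷-cong x≡0 r≋[]) [0#]≋[])
  ...   | no x≢0  = inj₂ (0 , s≤s z≤n , [] , x , x≢0 , ∷-cong refl r≋[])

  ∷ʳ≋·monic : ∀ {e} (w : Vec F e) ℓ ℓ⁻¹ → ℓ * ℓ⁻¹ ≡ 1# → Vec.toList w ++ [ ℓ ] ≋ ℓ ·ₚ monic (Vec.map (ℓ⁻¹ *_) w)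
  ∷ʳ≋·monic []      ℓ ℓ⁻¹ ℓℓ⁻¹≡1 = ∷-cong (sym (F.*-identityʳ ℓ)) ≋-refl
  ∷ʳ≋·monic (x ∷ w) ℓ ℓ⁻¹ ℓℓ⁻¹≡1 = ∷-cong x≡ℓ[ℓ⁻¹x] (∷ʳ≋·monic w ℓ ℓ⁻¹ ℓℓ⁻¹≡1)
    where
    x≡ℓ[ℓ⁻¹x] : x ≡ ℓ * (ℓ⁻¹ * x)
    x≡ℓ[ℓ⁻¹x] = begin
      x             ≡⟨ F.*-identityˡ x ⟨
      1# * x        ≡⟨ cong (_* x) ℓℓ⁻¹≡1 ⟨
      ℓ * ℓ⁻¹ * x   ≡⟨ F.*-assoc ℓ ℓ⁻¹ x ⟩
      ℓ * (ℓ⁻¹ * x) ∎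
      where open ≡-Reasoning

  record Bezout₂ (M a : Poly) : Set where
    constructor bezout₂
    field
      deg₂ : ℕ
      lower₂ : Vec F deg₂
      ∣M₂ : monic lower₂ ∣ M
      ∣a₂ : monic lower₂ ∣ a
      u₂ v₂ : Poly
      bezout₂-eq : monic lower₂ ≋ u₂ *ₚ M +ₚ v₂ *ₚ a
  open Bezout₂ public

  bezout-step : ∀ M Q r a X v → a ≋ M *ₚ Q +ₚ r → (v +ₚ -ₚ (X *ₚ Q)) *ₚ M +ₚ X *ₚ a ≋ v *ₚ M +ₚ X *ₚ r
  bezout-step M Q r a X v a≋ = begin
    (v +ₚ N) *ₚ M +ₚ X *ₚ a                          ≈⟨ P.+-congˡ (*ₚ-cong (≋-refl {X}) a≋) ⟩
    (v +ₚ N) *ₚ M +ₚ X *ₚ (M *ₚ Q +ₚ r)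
      ≈⟨ psolve 6 (λ v N M X Q r → (v :+ N) :* M :+ X :* (M :* Q :+ r) := (v :* M :+ X :* r) :+ (N :* M :+ X :* Q :* M))
                ≋-refl v N M X Q r ⟩
    (v *ₚ M +ₚ X *ₚ r) +ₚ (N *ₚ M +ₚ X *ₚ Q *ₚ M)   ≈⟨ P.+-congˡ (*ₚ-distribʳ M N (X *ₚ Q)) ⟨
    (v *ₚ M +ₚ X *ₚ r) +ₚ (N +ₚ X *ₚ Q) *ₚ M        ≈⟨ P.+-congˡ (*ₚ-cong (-ₚ‿inverseˡ (X *ₚ Q)) (≋-refl {M})) ⟩
    (v *ₚ M +ₚ X *ₚ r) +ₚ [] *ₚ M                    ≈⟨ +ₚ-identityʳ _ ⟩
    v *ₚ M +ₚ X *ₚ r                                 ∎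
    where
    open SR
    N = -ₚ (X *ₚ Q)

  -- The fuel f bounds the degree e, which drops at every division step.
  euclid : (f : ℕ) → ∀ {e} → e ℕ.< f → (β : Vec F e) (a : Poly) → Bezout₂ (monic β) a
  euclid (suc f) {e} (s≤s e≤f) β a with zero⊎leadingTerm (proj₂ (divMonic β a))
  ... | inj₁ r≋[] = bezout₂ e β ∣-refl (divides (proj₁ (divMonic β a)) M∣a) (constₚ 1#) []
                      (≋-sym (≋-trans (+ₚ-identityʳ _) (*ₚ-identityˡ (monic β))))
    where
    M∣a : monic β *ₚ proj₁ (divMonic β a) ≋ a
    M∣a = ≋-sym (≋-trans (divMonic-correct β a) (≋-trans (P.+-congˡ r≋[]) (+ₚ-identityʳ _)))
  ... | inj₂ (e′ , e′<e , w , ℓ , ℓ≢0 , r≋) with inverse ℓ ℓ≢0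
  ...   | ℓ⁻¹ , ℓℓ⁻¹≡1 = bezout₂ (deg₂ R) (lower₂ R) (∣a₂ R) G∣a (v₂ R +ₚ -ₚ (X *ₚ Q)) X bezout
    where
    M = monic β
    Q = proj₁ (divMonic β a)
    r = Vec.toList (proj₂ (divMonic β a))
    M̂ = monic (Vec.map (ℓ⁻¹ *_) w)
    R = euclid f (ℕₚ.<-≤-trans e′<e e≤f) (Vec.map (ℓ⁻¹ *_) w) M
    X = u₂ R *ₚ constₚ ℓ⁻¹
    a≋ : a ≋ M *ₚ Q +ₚ r
    a≋ = divMonic-correct β a
    r≋ℓM̂ : r ≋ constₚ ℓ *ₚ M̂
    r≋ℓM̂ = ≋-trans r≋ (≋-trans (∷ʳ≋·monic w ℓ ℓ⁻¹ ℓℓ⁻¹≡1) (≋-sym (constₚ-*ₚ ℓ M̂)))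
    G∣a : monic (lower₂ R) ∣ a
    G∣a = ∣-respʳ (≋-sym (≋-trans a≋ (P.+-congˡ r≋ℓM̂))) (∣-+ₚ (∣-*ₚʳ Q (∣a₂ R)) (∣-*ₚˡ (constₚ ℓ) (∣M₂ R)))
    M̂≋ℓ⁻¹r : M̂ ≋ constₚ ℓ⁻¹ *ₚ r
    M̂≋ℓ⁻¹r = begin
      M̂                            ≈⟨ *ₚ-identityˡ M̂ ⟨
      constₚ 1# *ₚ M̂               ≈⟨ P.*-congʳ (∷-cong (trans (sym ℓℓ⁻¹≡1) (F.*-comm ℓ ℓ⁻¹)) (≋-refl {[]})) ⟩
      constₚ (ℓ⁻¹ * ℓ) *ₚ M̂        ≈⟨ P.*-congʳ (constₚ-*ₚ ℓ⁻¹ (constₚ ℓ)) ⟨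
      constₚ ℓ⁻¹ *ₚ constₚ ℓ *ₚ M̂  ≈⟨ *ₚ-assoc (constₚ ℓ⁻¹) (constₚ ℓ) M̂ ⟩
      constₚ ℓ⁻¹ *ₚ (constₚ ℓ *ₚ M̂) ≈⟨ P.*-congˡ {constₚ ℓ⁻¹} r≋ℓM̂ ⟨
      constₚ ℓ⁻¹ *ₚ r              ∎
      where open SR
    bezout : monic (lower₂ R) ≋ (v₂ R +ₚ -ₚ (X *ₚ Q)) *ₚ M +ₚ X *ₚ a
    bezout = begin
      monic (lower₂ R)                          ≈⟨ bezout₂-eq R ⟩
      u₂ R *ₚ M̂ +ₚ v₂ R *ₚ M                    ≈⟨ P.+-congʳ (*ₚ-cong (≋-refl {u₂ R}) M̂≋ℓ⁻¹r) ⟩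
      u₂ R *ₚ (constₚ ℓ⁻¹ *ₚ r) +ₚ v₂ R *ₚ M
        ≈⟨ psolve 4 (λ u l r vM → u :* (l :* r) :+ vM := vM :+ u :* l :* r) ≋-refl (u₂ R) (constₚ ℓ⁻¹) r (v₂ R *ₚ M) ⟩
      v₂ R *ₚ M +ₚ X *ₚ r                       ≈⟨ bezout-step M Q r a X (v₂ R) a≋ ⟨
      (v₂ R +ₚ -ₚ (X *ₚ Q)) *ₚ M +ₚ X *ₚ a      ∎
      where open SR

  combination : List Poly → List Poly → Poly
  combination (u ∷ us) (c ∷ cs) = u *ₚ c +ₚ combination us cs
  combination _        _        = []

  ∣-combination : ∀ {h} us cs → All (h ∣_) cs → h ∣ combination us cs
  ∣-combination []       cs       _            = ∣-[]
  ∣-combination (u ∷ us) []       _            = ∣-[]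
  ∣-combination (u ∷ us) (c ∷ cs) (h∣c ∷ h∣cs) = ∣-+ₚ (∣-*ₚˡ u h∣c) (∣-combination us cs h∣cs)

  *ₚ-combination : ∀ M us cs → M *ₚ combination us cs ≋ combination us (map (M *ₚ_) cs)
  *ₚ-combination M []       cs       = *ₚ-zeroʳ M
  *ₚ-combination M (u ∷ us) []       = *ₚ-zeroʳ M
  *ₚ-combination M (u ∷ us) (c ∷ cs) =
    ≋-trans (psolve 4 (λ M u c x → M :* (u :* c :+ x) := u :* (M :* c) :+ M :* x) ≋-refl M u c (combination us cs))
            (P.+-congˡ (*ₚ-combination M us cs))

  record Bezout (M : Poly) (cs : List Poly) : Set where
    constructor bezout
    field
      deg : ℕ
      lower : Vec F deg
      ∣M : monic lower ∣ M
      ∣cs : All (monic lower ∣_) cs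
      u : Poly
      us : List Poly
      bezout-eq : monic lower ≋ u *ₚ M +ₚ combination us cs
  open Bezout public

  monicGcd : ∀ {e} (β : Vec F e) cs → Bezout (monic β) cs
  monicGcd β [] = bezout _ β ∣-refl [] (constₚ 1#) [] (≋-sym (≋-trans (+ₚ-identityʳ _) (*ₚ-identityˡ (monic β))))
  monicGcd {e} β (c ∷ cs) =
    bezout (deg G) (lower G) (∣-trans (∣M G) (∣M₂ E)) (∣-trans (∣M G) (∣a₂ E) ∷ ∣cs G)
           (u G *ₚ u₂ E) (u G *ₚ v₂ E ∷ us G) bezout-G
    where
    E = euclid (suc e) ℕₚ.≤-refl β c
    G = monicGcd (lower₂ E) cs
    bezout-G : monic (lower G) ≋ (u G *ₚ u₂ E) *ₚ monic β +ₚ combination (u G *ₚ v₂ E ∷ us G) (c ∷ cs)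
    bezout-G = ≋-trans (bezout-eq G) (≋-trans (P.+-congʳ (*ₚ-cong (≋-refl {u G}) (bezout₂-eq E)))
      (psolve 6 (λ a b M d c x → a :* (b :* M :+ d :* c) :+ x := (a :* b) :* M :+ ((a :* d) :* c :+ x)) ≋-refl
                (u G) (u₂ E) (monic β) (v₂ E) c (combination (us G) cs)))

  monicGcd-greatest : ∀ {e} (β : Vec F e) cs h → h ∣ monic β → All (h ∣_) cs → h ∣ monic (lower (monicGcd β cs))
  monicGcd-greatest β cs h h∣M h∣cs = ∣-respʳ (≋-sym (bezout-eq G)) (∣-+ₚ (∣-*ₚˡ (u G) h∣M) (∣-combination (us G) cs h∣cs))
    where G = monicGcd β cs

  monic-∣⇒≤ : ∀ {m e m′ e′} → IsMonic m e → IsMonic m′ e′ → m ∣ m′ → e ℕ.≤ e′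
  monic-∣⇒≤ {m} {e} {m′} {e′} m-monic (Bm′ , m′ₑ′≡1) (divides h mh≋m′) = ℕₚ.≮⇒≥ λ e′<e → 0≢1 (begin
    0#                  ≡⟨ coeff-*ₚ-zeroʳ m e′ ⟨
    coeff (m *ₚ []) e′  ≡⟨ coeff-*ₚ-congʳ e′ m (h≋[] e′<e) ⟨
    coeff (m *ₚ h) e′   ≡⟨ at mh≋m′ e′ ⟩
    coeff m′ e′         ≡⟨ m′ₑ′≡1 ⟩
    1#                  ∎)
    where
    open ≡-Reasoning
    h≋[] : e′ ℕ.< e → h ≋ []
    h≋[] e′<e = degreeBelow-zero (degreeBelow-cancel-monic {t = 0} m h m-monic
      (degreeBelow-cong (≋-sym mh≋m′) (degreeBelow-mono (subst (e′ ℕ.<_) (sym (ℕₚ.+-identityʳ e)) e′<e) Bm′)))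

  monic-∣-antisym : ∀ {e e′} (β : Vec F e) (β′ : Vec F e′) → monic β ∣ monic β′ → monic β′ ∣ monic β →
                    e ≡ e′ × Vec.toList β ≡ Vec.toList β′
  monic-∣-antisym β β′ β∣β′ β′∣β
    with refl ← ℕₚ.≤-antisym (monic-∣⇒≤ (monic-isMonic β) (monic-isMonic β′) β∣β′)
                             (monic-∣⇒≤ (monic-isMonic β′) (monic-isMonic β) β′∣β)
    = refl , cong Vec.toList (same-degree β∣β′)
    where
    same-degree : ∀ {e} {β β′ : Vec F e} → monic β ∣ monic β′ → β ≡ β′
    same-degree {e} {β} {β′} (divides h βh≋β′) =
      monic-injective β β′ (≋-sym (≋-trans (≋-sym βh≋β′) (≋-trans (P.*-congˡ {monic β} h≋1) (*ₚ-identityʳ (monic β)))))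
      where
      open ≡-Reasoning
      Bh : DegreeBelow h 1
      Bh = degreeBelow-cancel-monic (monic β) h (monic-isMonic β)
             (degreeBelow-cong (≋-sym βh≋β′) (subst (DegreeBelow (monic β′)) (ℕₚ.+-comm 1 e) (proj₁ (monic-isMonic β′))))
      h₀≡1 : coeff h 0 ≡ 1#
      h₀≡1 = begin
        coeff h 0                       ≡⟨ F.*-identityˡ _ ⟨
        1# * coeff h 0                  ≡⟨ cong (_* coeff h 0) (proj₂ (monic-isMonic β)) ⟨
        coeff (monic β) e * coeff h 0   ≡⟨ coeff-*ₚ-leading e 0 (monic β) h (proj₁ (monic-isMonic β)) Bh ⟨
        coeff (monic β *ₚ h) (e ℕ.+ 0)  ≡⟨ at βh≋β′ (e ℕ.+ 0) ⟩
        coeff (monic β′) (e ℕ.+ 0)      ≡⟨ cong (coeff (monic β′)) (ℕₚ.+-identityʳ e) ⟩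
        coeff (monic β′) e              ≡⟨ proj₂ (monic-isMonic β′) ⟩
        1#                              ∎
      h≋1 : h ≋ constₚ 1#
      h≋1 = mk≋ λ { zero → h₀≡1 ; (suc t) → vanish Bh (suc t) (s≤s z≤n) }

  tabulate-coeff-∷ʳ : ∀ n p → DegreeBelow p (suc n) → Vec.toList (Vec.tabulate {n = n} (coeff p ∘ toℕ)) ++ [ coeff p n ] ≋ p
  tabulate-coeff-∷ʳ zero    p B = mk≋ λ { zero → refl ; (suc t) → sym (vanish B (suc t) (s≤s z≤n)) }
  tabulate-coeff-∷ʳ (suc n) p B = mk≋ λ
    { zero    → refl
    ; (suc t) → trans (cong (λ r → coeff r t) (sym tail≡))
                      (trans (at (tabulate-coeff-∷ʳ n (tailₚ p) (degreeBelow-tailₚ {p} B)) t) (coeff-tailₚ p t))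
    }
    where
    tail≡ : Vec.toList (Vec.tabulate {n = n} (coeff (tailₚ p) ∘ toℕ)) ++ [ coeff (tailₚ p) n ]
          ≡ Vec.toList (Vec.tabulate {n = n} (coeff p ∘ suc ∘ toℕ)) ++ [ coeff p (suc n) ]
    tail≡ = cong₂ (λ (v : Vec F n) x → Vec.toList v ++ [ x ]) (Vecₚ.tabulate-cong (coeff-tailₚ p ∘ toℕ)) (coeff-tailₚ p n)

  tabulate-coeff-toList : ∀ {n} (v : Vec F n) c → Vec.tabulate (coeff (Vec.toList v ++ [ c ]) ∘ toℕ) ≡ v
  tabulate-coeff-toList []      c = refl
  tabulate-coeff-toList (x ∷ v) c = cong (x ∷_) (tabulate-coeff-toList v c)

  ∷ʳ-injective : ∀ {n} (v v′ : Vec F n) x → Vec.toList v ++ [ x ] ≋ Vec.toList v′ ++ [ x ] → v ≡ v′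
  ∷ʳ-injective []      []        x e = refl
  ∷ʳ-injective (a ∷ v) (a′ ∷ v′) x e = cong₂ _∷_ (at e 0) (∷ʳ-injective v v′ x (tailₚ-cong e))

  monic-degree-0 : ∀ {e} (β : Vec F e) → e ≡ 0 → monic β ≡ constₚ 1#
  monic-degree-0 [] refl = refl

  monic-*ₚ-cancelˡ : ∀ {M k x y} → IsMonic M k → M *ₚ x ≋ M *ₚ y → x ≋ y
  monic-*ₚ-cancelˡ {M} {k} {x} {y} M-monic Mx≋My =
    Pₚ.x∙y⁻¹≈ε⇒x≈y x y (degreeBelow-zero (degreeBelow-cancel-monic {t = 0} M _ M-monic
      (degreeBelow-cong (≋-sym M[x-y]≋[]) (mkDegreeBelow λ _ _ → refl))))
    where
    M[x-y]≋[] : M *ₚ (x +ₚ -ₚ y) ≋ []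
    M[x-y]≋[] = begin
      M *ₚ (x +ₚ -ₚ y)         ≈⟨ *ₚ-distribˡ M x (-ₚ y) ⟩
      M *ₚ x +ₚ M *ₚ (-ₚ y)    ≈⟨ +ₚ-cong Mx≋My (≋-sym (Pₚ.-‿distribʳ-* M y)) ⟩
      M *ₚ y +ₚ -ₚ (M *ₚ y)    ≈⟨ -ₚ‿inverseʳ (M *ₚ y) ⟩
      []                       ∎
      where open SR

module Columns {q : ℕ} (𝔽 : FiniteField q) (d : ℕ) where
  open FiniteField 𝔽
  open PolynomialRing 𝔽
  open MonicGcd 𝔽
  open import Algebra.Solver.Ring.NaturalCoefficients P.commutativeSemiring (λ _ _ → nothing) renaming (solve to psolve)
  import Relation.Binary.Reasoning.Setoid P.setoid as SR

  -- f = y^m + …, so only the x^0-coefficient of f has a y^m term, and it is 1.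
  topCoeff : Fin (suc d) → F
  topCoeff zero    = 1#
  topCoeff (suc _) = 0#

  -- The x-coefficients c₀(y), …, c_d(y) of f, each stored by its coefficients below y^m.
  Columns : ℕ → Set
  Columns m = Vec (Vec F m) (suc d)

  column : ∀ {m} → Fin (suc d) → Vec F m → Poly
  column j v = Vec.toList v ++ [ topCoeff j ]

  col : ∀ {m} → Columns m → Fin (suc d) → Poly
  col C j = column j (Vec.lookup C j)

  colList : ∀ {m} → Columns m → List Poly
  colList C = List.tabulate (col C)

  restCols : ∀ {m} → Columns m → List Poly
  restCols C = List.tabulate (col C ∘ suc)

  gcdOfColumns : ∀ {m} (C : Columns m) → Bezout (monic (Vec.lookup C zero)) (restCols C)
  gcdOfColumns C = monicGcd (Vec.lookup C zero) (restCols C)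

  gcdDegree : ∀ {m} → Columns m → ℕ
  gcdDegree C = deg (gcdOfColumns C)

  gcdLower : ∀ {m} (C : Columns m) → Vec F (gcdDegree C)
  gcdLower C = lower (gcdOfColumns C)

  IsGcdOf : ∀ {m} → Columns m → Poly → Set
  IsGcdOf C g = (∀ j → g ∣ col C j) × (∀ h → (∀ j → h ∣ col C j) → h ∣ g)

  gcdOfColumns-isGcd : ∀ {m} (C : Columns m) → IsGcdOf C (monic (gcdLower C))
  gcdOfColumns-isGcd C =
    (λ { zero → ∣M (gcdOfColumns C) ; (suc j) → Allₚ.tabulate⁻ (∣cs (gcdOfColumns C)) j }) ,
    (λ h h∣C → monicGcd-greatest (Vec.lookup C zero) (restCols C) h (h∣C zero) (Allₚ.tabulate⁺ (h∣C ∘ suc)))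

  isGcdOf-unique : ∀ {m k} (C : Columns m) (β : Vec F k) → IsGcdOf C (monic β) →
                   k ≡ gcdDegree C × Vec.toList β ≡ Vec.toList (gcdLower C)
  isGcdOf-unique C β (β∣C , greatest) =
    monic-∣-antisym β (gcdLower C) (proj₂ (gcdOfColumns-isGcd C) (monic β) β∣C) (greatest _ (proj₁ (gcdOfColumns-isGcd C)))

  gcdDegree≤ : ∀ {m} (C : Columns m) → gcdDegree C ℕ.≤ m
  gcdDegree≤ C = monic-∣⇒≤ (monic-isMonic (gcdLower C)) (monic-isMonic (Vec.lookup C zero)) (∣M (gcdOfColumns C))

  isGcdOf⇒isMonicGCD : ∀ {m} (C : Columns m) {g} → IsGcdOf C g → IsMonicGCD (colList C) g
  isGcdOf⇒isMonicGCD C {g} (g∣C , greatest) =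
    (λ c c∈C → let j , c≡ = ∈ₚ.∈-tabulate⁻ {f = col C} c∈C in subst (g ∣ₚ_) (sym c≡) (∣⇒∣ₚ (g∣C j))) ,
    (λ h h∣C → ∣⇒∣ₚ (greatest h (λ j → ∣ₚ⇒∣ (h∣C (col C j) (∈ₚ.∈-tabulate⁺ {f = col C} j)))))

  isMonicGCD⇒isGcdOf : ∀ {m} (C : Columns m) {g} → IsMonicGCD (colList C) g → IsGcdOf C g
  isMonicGCD⇒isGcdOf C (g∣C , greatest) =
    (λ j → ∣ₚ⇒∣ (g∣C (col C j) (∈ₚ.∈-tabulate⁺ {f = col C} j))) ,
    (λ h h∣C → ∣ₚ⇒∣ (greatest h (λ c c∈C →
      let j , c≡ = ∈ₚ.∈-tabulate⁻ {f = col C} c∈C in subst (h ∣ₚ_) (sym c≡) (∣⇒∣ₚ (h∣C j)))))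

  gcdDegree⇒GCDDegree : ∀ {m} (C : Columns m) {k} → gcdDegree C ≡ k → GCDDegree (colList C) k
  gcdDegree⇒GCDDegree C e =
    Vec.toList (gcdLower C) , trans (Vecₚ.length-toList (gcdLower C)) e , isGcdOf⇒isMonicGCD C (gcdOfColumns-isGcd C)

  GCDDegree⇒gcdDegree : ∀ {m} (C : Columns m) {k} → GCDDegree (colList C) k → gcdDegree C ≡ k
  GCDDegree⇒gcdDegree C (c , length≡k , isGcd) = trans (sym (proj₁ (isGcdOf-unique C (Vec.fromList c) c-isGcd))) length≡k
    where
    c-isGcd : IsGcdOf C (monic (Vec.fromList c))
    c-isGcd = subst (IsGcdOf C) (cong (_++ [ 1# ]) (sym (Vecₚ.toList∘fromList c))) (isMonicGCD⇒isGcdOf C isGcd)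

  degreeBelow-column : ∀ {m} j (v : Vec F m) → DegreeBelow (column j v) (suc m)
  degreeBelow-column {m} j v = subst (DegreeBelow (column j v)) length-column (degreeBelow-length (column j v))
    where
    length-column : length (column j v) ≡ suc m
    length-column = trans (Listₚ.length-++ (Vec.toList v)) (trans (ℕₚ.+-comm _ 1) (cong suc (Vecₚ.length-toList v)))

  coeff-column-top : ∀ {m} j (v : Vec F m) → coeff (column j v) m ≡ topCoeff j
  coeff-column-top j []      = refl
  coeff-column-top j (x ∷ v) = coeff-column-top j v

  -- Multiplying all columns by a monic β of degree k maps the tuples with coprime columns
  -- bijectively onto the tuples whose gcd is β.
  module Scale {k : ℕ} (β : Vec F k) where
    M : Poly
    M = monic β

    M-monic : IsMonic M k
    M-monic = monic-isMonic β

    scaleColumn : ∀ {m} → Fin (suc d) → Vec F m → Vec F (k ℕ.+ m)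
    scaleColumn j v = Vec.tabulate (coeff (M *ₚ column j v) ∘ toℕ)

    column-scaleColumn : ∀ {m} j (v : Vec F m) → column j (scaleColumn j v) ≋ M *ₚ column j v
    column-scaleColumn {m} j v =
      subst (λ x → Vec.toList (scaleColumn j v) ++ [ x ] ≋ M *ₚ column j v) top (tabulate-coeff-∷ʳ (k ℕ.+ m) _ below)
      where
      top : coeff (M *ₚ column j v) (k ℕ.+ m) ≡ topCoeff j
      top = trans (coeff-*ₚ-leading k m M (column j v) (proj₁ M-monic) (degreeBelow-column j v))
                  (trans (cong₂ _*_ (proj₂ M-monic) (coeff-column-top j v)) (F.*-identityˡ _))
      below : DegreeBelow (M *ₚ column j v) (suc (k ℕ.+ m))
      below = subst (DegreeBelow _) (ℕₚ.+-suc k m) (degreeBelow-*ₚ k M (column j v) (proj₁ M-monic) (degreeBelow-column j v))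

    scaleColumns : ∀ {m} → Columns m → Columns (k ℕ.+ m)
    scaleColumns C = Vec.tabulate (λ j → scaleColumn j (Vec.lookup C j))

    lookup-scaleColumns : ∀ {m} (C : Columns m) j → Vec.lookup (scaleColumns C) j ≡ scaleColumn j (Vec.lookup C j)
    lookup-scaleColumns C = Vecₚ.lookup∘tabulate (λ j → scaleColumn j (Vec.lookup C j))

    col-scaleColumns : ∀ {m} (C : Columns m) j → col (scaleColumns C) j ≋ M *ₚ col C j
    col-scaleColumns C j = ≋-trans (≡⇒≋ (cong (column j) (lookup-scaleColumns C j))) (column-scaleColumn j (Vec.lookup C j))

    scaleColumn-injective : ∀ {m} j {v v′ : Vec F m} → scaleColumn j v ≡ scaleColumn j v′ → v ≡ v′
    scaleColumn-injective j {v} {v′} e = ∷ʳ-injective v v′ (topCoeff j) (monic-*ₚ-cancelˡ M-monic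
      (≋-trans (≋-sym (column-scaleColumn j v)) (≋-trans (≡⇒≋ (cong (column j) e)) (column-scaleColumn j v′))))

    scaleColumns-injective : ∀ {m} {C C′ : Columns m} → scaleColumns C ≡ scaleColumns C′ → C ≡ C′
    scaleColumns-injective {C = C} {C′} e = lookup-ext C C′ λ j → scaleColumn-injective j
      (trans (sym (lookup-scaleColumns C j)) (trans (cong (λ T → Vec.lookup T j) e) (lookup-scaleColumns C′ j)))

    coprime⇒gcd-scaleColumns : ∀ {m} (C : Columns m) → gcdDegree C ≡ 0 → IsGcdOf (scaleColumns C) M
    coprime⇒gcd-scaleColumns C deg≡0 = (λ j → divides (col C j) (≋-sym (col-scaleColumns C j))) , greatest
      where
      G = gcdOfColumns C
      C₀ = col C zero
      1≋ : constₚ 1# ≋ u G *ₚ C₀ +ₚ combination (us G) (restCols C)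
      1≋ = ≋-trans (≡⇒≋ (sym (monic-degree-0 (gcdLower C) deg≡0))) (bezout-eq G)
      M≋ : M ≋ u G *ₚ (M *ₚ C₀) +ₚ combination (us G) (map (M *ₚ_) (restCols C))
      M≋ = begin
        M                                                       ≈⟨ *ₚ-identityʳ M ⟨
        M *ₚ constₚ 1#                                          ≈⟨ P.*-congˡ {M} 1≋ ⟩
        M *ₚ (u G *ₚ C₀ +ₚ combination (us G) (restCols C))     ≈⟨ *ₚ-distribˡ M _ _ ⟩
        M *ₚ (u G *ₚ C₀) +ₚ M *ₚ combination (us G) (restCols C)
          ≈⟨ +ₚ-cong (psolve 3 (λ M u c → M :* (u :* c) := u :* (M :* c)) ≋-refl M (u G) C₀) (*ₚ-combination M (us G) _) ⟩
        u G *ₚ (M *ₚ C₀) +ₚ combination (us G) (map (M *ₚ_) (restCols C)) ∎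
        where open SR
      greatest : ∀ h → (∀ j → h ∣ col (scaleColumns C) j) → h ∣ M
      greatest h h∣MC = ∣-respʳ (≋-sym M≋) (∣-+ₚ (∣-*ₚˡ (u G) (∣-respʳ (col-scaleColumns C zero) (h∣MC zero)))
        (∣-combination (us G) _ (subst (All (h ∣_)) (sym (Listₚ.map-tabulate (col C ∘ suc) (M *ₚ_)))
          (Allₚ.tabulate⁺ (λ j → ∣-respʳ (col-scaleColumns C (suc j)) (h∣MC (suc j)))))))

    gcd-scaleColumns⇒coprime : ∀ {m} (C : Columns m) → IsGcdOf (scaleColumns C) M → gcdDegree C ≡ 0
    gcd-scaleColumns⇒coprime C (_ , greatest) =
      ℕₚ.n≤0⇒n≡0 (ℕₚ.+-cancelˡ-≤ k (gcdDegree C) 0 (subst (k ℕ.+ gcdDegree C ℕ.≤_) (sym (ℕₚ.+-identityʳ k)) k+deg≤k))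
      where
      MG∣M : M *ₚ monic (gcdLower C) ∣ M
      MG∣M = greatest _ (λ j → ∣-respʳ (≋-sym (col-scaleColumns C j)) (∣-*ₚ-cong M (proj₁ (gcdOfColumns-isGcd C) j)))
      k+deg≤k : k ℕ.+ gcdDegree C ℕ.≤ k
      k+deg≤k = monic-∣⇒≤ (monic-*ₚ M-monic (monic-isMonic (gcdLower C))) M-monic MG∣M

    quotientColumn : ∀ {m} (T : Columns (k ℕ.+ m)) j → M ∣ col T j → Σ[ v ∈ Vec F m ] scaleColumn j v ≡ Vec.lookup T j
    quotientColumn {m} T j (divides h Mh≋T) = v , (begin
      scaleColumn j v                                           ≡⟨ Vecₚ.tabulate-cong (λ i → coeff-*ₚ-congʳ (toℕ i) M column≋h) ⟩
      Vec.tabulate (coeff (M *ₚ h) ∘ toℕ)                       ≡⟨ Vecₚ.tabulate-cong (at Mh≋T ∘ toℕ) ⟩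
      Vec.tabulate (coeff (col T j) ∘ toℕ)                      ≡⟨ tabulate-coeff-toList (Vec.lookup T j) (topCoeff j) ⟩
      Vec.lookup T j                                            ∎)
      where
      open ≡-Reasoning
      Bh : DegreeBelow h (suc m)
      Bh = degreeBelow-cancel-monic M h M-monic (degreeBelow-cong (≋-sym Mh≋T)
             (subst (DegreeBelow (col T j)) (sym (ℕₚ.+-suc k m)) (degreeBelow-column j (Vec.lookup T j))))
      hₘ≡top : coeff h m ≡ topCoeff j
      hₘ≡top = begin
        coeff h m                 ≡⟨ F.*-identityˡ _ ⟨
        1# * coeff h m            ≡⟨ cong (_* coeff h m) (proj₂ M-monic) ⟨
        coeff M k * coeff h m     ≡⟨ coeff-*ₚ-leading k m M h (proj₁ M-monic) Bh ⟨
        coeff (M *ₚ h) (k ℕ.+ m)  ≡⟨ at Mh≋T (k ℕ.+ m) ⟩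
        coeff (col T j) (k ℕ.+ m) ≡⟨ coeff-column-top j (Vec.lookup T j) ⟩
        topCoeff j                ∎
      v : Vec F m
      v = Vec.tabulate (coeff h ∘ toℕ)
      column≋h : column j v ≋ h
      column≋h = subst (λ x → Vec.toList v ++ [ x ] ≋ h) hₘ≡top (tabulate-coeff-∷ʳ m h Bh)

    scaleColumns-surjective : ∀ {m} (T : Columns (k ℕ.+ m)) → IsGcdOf T M → Σ[ C ∈ Columns m ] scaleColumns C ≡ T
    scaleColumns-surjective T (M∣T , _) = C , lookup-ext (scaleColumns C) T λ j → begin
      Vec.lookup (scaleColumns C) j        ≡⟨ lookup-scaleColumns C j ⟩
      scaleColumn j (Vec.lookup C j)       ≡⟨ cong (scaleColumn j) (Vecₚ.lookup∘tabulate (λ j → proj₁ (quotient j)) j) ⟩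
      scaleColumn j (proj₁ (quotient j))   ≡⟨ proj₂ (quotient j) ⟩
      Vec.lookup T j                       ∎
      where
      open ≡-Reasoning
      quotient = λ j → quotientColumn T j (M∣T j)
      C = Vec.tabulate (λ j → proj₁ (quotient j))

module Counting {q : ℕ} (𝔽 : FiniteField q) (d : ℕ) where
  open FiniteField 𝔽 using (F; elements; enum; _≟_; 1#)
  open MonicGcd 𝔽 using (monic)
  open Columns 𝔽 d
  open import Data.Nat using (_+_; _*_; _^_; _∸_)

  elements-unique : Unique elements
  elements-unique = Uniqueₚ.tabulate⁺ (λ {i} {j} eq →
    trans (sym (Inverse.strictlyInverseʳ enum i)) (trans (cong (Inverse.from enum) eq) (Inverse.strictlyInverseʳ enum j)))

  elements-complete : ∀ x → x ∈ elements
  elements-complete x = subst (_∈ elements) (Inverse.strictlyInverseˡ enum x) (∈ₚ.∈-tabulate⁺ (Inverse.from enum x))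

  allVecsF : ∀ m → List (Vec F m)
  allVecsF m = allVecs m elements

  length-allVecsF : ∀ m → length (allVecsF m) ≡ q ^ m
  length-allVecsF m = trans (length-allVecs m elements) (cong (_^ m) (Listₚ.length-tabulate _))

  allColumns : ∀ m → List (Columns m)
  allColumns m = allVecs (suc d) (allVecsF m)

  allColumns-unique : ∀ m → Unique (allColumns m)
  allColumns-unique m = allVecs-unique (suc d) (allVecs-unique m elements-unique)

  allColumns-complete : ∀ m C → C ∈ allColumns m
  allColumns-complete m = allVecs-complete (suc d) (allVecs-complete m elements-complete)

  length-allColumns : ∀ m → length (allColumns m) ≡ q ^ (m * suc d)
  length-allColumns m = trans (length-allVecs (suc d) (allVecsF m))
    (trans (cong (_^ suc d) (length-allVecsF m)) (ℕₚ.^-*-assoc q m (suc d)))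

  #gcdDegree : ℕ → ℕ → ℕ
  #gcdDegree m k = count (λ C → gcdDegree {m} C ℕ.≟ k) (allColumns m)

  gcdLower≡? : ∀ {m k} (β : Vec F k) → Decidable (λ (T : Columns m) → Vec.toList (gcdLower T) ≡ Vec.toList β)
  gcdLower≡? β T = Listₚ.≡-dec _≟_ (Vec.toList (gcdLower T)) (Vec.toList β)

  #gcdLower≡ : ∀ k j (β : Vec F k) → count (gcdLower≡? β) (allColumns (k + j)) ≡ #gcdDegree j 0
  #gcdLower≡ k j β = begin
    count (gcdLower≡? β) (allColumns (k + j))
      ≡⟨ count-bijection scaleColumns scaleColumns-injective (allColumns-unique j) (allColumns-unique (k + j))
           (allColumns-complete j) (allColumns-complete (k + j)) (gcdLower≡? β) (λ {T} → scaleColumns-surjective T ∘ gcd≡M T) ⟩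
    count (gcdLower≡? β ∘ scaleColumns) (allColumns j)
      ≡⟨ count-≐ (gcdLower≡? β ∘ scaleColumns) (λ C → gcdDegree C ℕ.≟ 0)
           ((λ {C} → gcd-scaleColumns⇒coprime C ∘ gcd≡M (scaleColumns C)) ,
            (λ {C} → sym ∘ proj₂ ∘ isGcdOf-unique (scaleColumns C) β ∘ coprime⇒gcd-scaleColumns C))
           (allColumns j) ⟩
    #gcdDegree j 0 ∎
    where
    open ≡-Reasoning
    open Scale β
    gcd≡M : ∀ {m} (T : Columns m) → Vec.toList (gcdLower T) ≡ Vec.toList β → IsGcdOf T M
    gcd≡M T e = subst (IsGcdOf T) (cong (_++ [ 1# ]) e) (gcdOfColumns-isGcd T)

  #gcdDegree-+ : ∀ k j → #gcdDegree (k + j) k ≡ q ^ k * #gcdDegree j 0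
  #gcdDegree-+ k j = begin
    #gcdDegree (k + j) k
      ≡⟨ count-fibres (λ T → gcdDegree T ℕ.≟ k) (gcdLower≡? {k + j}) (allVecsF k)
                      (λ {T} → one {T}) (λ {T} → none {T}) (allColumns (k + j)) ⟩
    sum (map (λ β → count (gcdLower≡? β) (allColumns (k + j))) (allVecsF k))
      ≡⟨ sum-map-const _ (#gcdLower≡ k j) (allVecsF k) ⟩
    length (allVecsF k) * #gcdDegree j 0
      ≡⟨ cong (_* #gcdDegree j 0) (length-allVecsF k) ⟩
    q ^ k * #gcdDegree j 0 ∎
    where
    open ≡-Reasoning
    one : ∀ {T} → gcdDegree T ≡ k → count (λ β → gcdLower≡? β T) (allVecsF k) ≡ 1
    one {T} e with reindex (gcdLower T) e
    ... | w , w≡ = count-unique (λ β → gcdLower≡? β T) (allVecs-unique k elements-unique)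
                     (allVecs-complete k elements-complete w) (sym w≡)
                     (λ {β} β≡ → trans (sym (cast-is-id refl β)) (Vecₚ.toList-injective refl β w (trans (sym β≡) (sym w≡))))
    none : ∀ {T} → gcdDegree T ≢ k → count (λ β → gcdLower≡? β T) (allVecsF k) ≡ 0
    none {T} ≢k = count-none (λ β → gcdLower≡? β T) (All.universal (λ β e → ≢k (begin
      gcdDegree T                      ≡⟨ Vecₚ.length-toList (gcdLower T) ⟨
      length (Vec.toList (gcdLower T)) ≡⟨ cong length e ⟩
      length (Vec.toList β)            ≡⟨ Vecₚ.length-toList β ⟩
      k                                ∎)) (allVecsF k))

  sum-#gcdDegree : ∀ m → sum (applyUpTo (#gcdDegree m) (suc m)) ≡ q ^ (m * suc d)
  sum-#gcdDegree m = begin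
    sum (applyUpTo (#gcdDegree m) (suc m))
      ≡⟨ cong sum (Listₚ.map-applyUpTo id (#gcdDegree m) (suc m)) ⟨
    sum (map (#gcdDegree m) (upTo (suc m)))
      ≡⟨ count-fibres U? (λ k C → gcdDegree C ℕ.≟ k) (upTo (suc m))
                      (λ {C} → one {C}) (λ ¬⊤ → ⊥-elim (¬⊤ tt)) (allColumns m) ⟨
    count U? (allColumns m)
      ≡⟨ count-all U? (All.universal (λ _ → tt) (allColumns m)) ⟩
    length (allColumns m)
      ≡⟨ length-allColumns m ⟩
    q ^ (m * suc d) ∎
    where
    open ≡-Reasoning
    one : ∀ {C} → U C → count (λ k → gcdDegree C ℕ.≟ k) (upTo (suc m)) ≡ 1
    one {C} _ = count-unique (λ k → gcdDegree C ℕ.≟ k) (Uniqueₚ.upTo⁺ (suc m))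
                             (∈ₚ.∈-upTo⁺ (s≤s (gcdDegree≤ C))) refl sym

  #gcdDegree-suc : ∀ {m k} → k ℕ.≤ m → #gcdDegree (suc m) (suc k) ≡ q * #gcdDegree m k
  #gcdDegree-suc {m} {k} k≤m = subst (λ m → #gcdDegree (suc m) (suc k) ≡ q * #gcdDegree m k) (ℕₚ.m+[n∸m]≡n k≤m) (begin
    #gcdDegree (suc k + j) (suc k) ≡⟨ #gcdDegree-+ (suc k) j ⟩
    q ^ suc k * #gcdDegree j 0     ≡⟨ ℕₚ.*-assoc q (q ^ k) _ ⟩
    q * (q ^ k * #gcdDegree j 0)   ≡⟨ cong (q *_) (#gcdDegree-+ k j) ⟨
    q * #gcdDegree (k + j) k       ∎)
    where
    open ≡-Reasoning
    j = m ∸ k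

  #gcdDegree-0-suc : ∀ m → #gcdDegree (suc m) 0 + q * q ^ (m * suc d) ≡ q ^ (suc m * suc d)
  #gcdDegree-0-suc m = begin
    #gcdDegree (suc m) 0 + q * q ^ (m * suc d)
      ≡⟨ cong (λ t → #gcdDegree (suc m) 0 + q * t) (sum-#gcdDegree m) ⟨
    #gcdDegree (suc m) 0 + q * sum (applyUpTo (#gcdDegree m) (suc m))
      ≡⟨ cong (#gcdDegree (suc m) 0 +_) (sum-map-* q (applyUpTo (#gcdDegree m) (suc m))) ⟨
    #gcdDegree (suc m) 0 + sum (map (q *_) (applyUpTo (#gcdDegree m) (suc m)))
      ≡⟨ cong (λ ns → #gcdDegree (suc m) 0 + sum ns) (Listₚ.map-applyUpTo (#gcdDegree m) (q *_) (suc m)) ⟩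
    #gcdDegree (suc m) 0 + sum (applyUpTo (λ k → q * #gcdDegree m k) (suc m))
      ≡⟨ cong (λ ns → #gcdDegree (suc m) 0 + sum ns) (applyUpTo-cong (suc m) (#gcdDegree-suc ∘ ℕₚ.≤-pred)) ⟨
    sum (applyUpTo (#gcdDegree (suc m)) (suc (suc m)))
      ≡⟨ sum-#gcdDegree (suc m) ⟩
    q ^ (suc m * suc d) ∎
    where open ≡-Reasoning

  #gcdDegree-0 : ∀ m → #gcdDegree (suc m) 0 ≡ q ^ (m * suc d) * q * (q ^ d ∸ 1)
  #gcdDegree-0 m = begin
    c                               ≡⟨ ℕₚ.m+n∸n≡m c (X * q) ⟨
    c + X * q ∸ X * q               ≡⟨ cong (λ t → c + t ∸ X * q) (ℕₚ.*-comm X q) ⟩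
    c + q * X ∸ X * q               ≡⟨ cong (_∸ X * q) (#gcdDegree-0-suc m) ⟩
    q ^ (suc m * suc d) ∸ X * q     ≡⟨ cong₂ _∸_ power (sym (ℕₚ.*-identityʳ (X * q))) ⟩
    X * q * q ^ d ∸ X * q * 1       ≡⟨ ℕₚ.*-distribˡ-∸ (X * q) (q ^ d) 1 ⟨
    X * q * (q ^ d ∸ 1)             ∎
    where
    open ≡-Reasoning
    c = #gcdDegree (suc m) 0
    X = q ^ (m * suc d)
    power : q ^ (suc m * suc d) ≡ X * q * q ^ d
    power = trans (ℕₚ.^-distribˡ-+-* q (suc d) (m * suc d))
                  (solve 3 (λ q Qd X → q :* Qd :* X := X :* q :* Qd) refl q (q ^ d) X)
      where open +-*-Solver

  #gcdDegree-closed : ∀ k j → #gcdDegree (k + suc j) k * q ^ d * q ^ (d * k) ≡ (q ^ d ∸ 1) * q ^ ((k + suc j) * suc d)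
  #gcdDegree-closed k j = begin
    #gcdDegree (k + suc j) k * q ^ d * q ^ (d * k)
      ≡⟨ cong (λ t → t * q ^ d * q ^ (d * k)) (trans (#gcdDegree-+ k (suc j)) (cong (q ^ k *_) (#gcdDegree-0 j))) ⟩
    q ^ k * (X * q * (q ^ d ∸ 1)) * q ^ d * q ^ (d * k)
      ≡⟨ solve 6 (λ Qk X q Y Qd Qdk → Qk :* (X :* q :* Y) :* Qd :* Qdk := Y :* (Qk :* Qdk :* (X :* (q :* Qd))))
               refl (q ^ k) X q (q ^ d ∸ 1) (q ^ d) (q ^ (d * k)) ⟩
    (q ^ d ∸ 1) * (q ^ k * q ^ (d * k) * (X * (q * q ^ d)))
      ≡⟨ cong ((q ^ d ∸ 1) *_) power ⟨
    (q ^ d ∸ 1) * q ^ ((k + suc j) * suc d) ∎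
    where
    open ≡-Reasoning
    open +-*-Solver
    X = q ^ (j * suc d)
    power : q ^ ((k + suc j) * suc d) ≡ q ^ k * q ^ (d * k) * (X * (q * q ^ d))
    power = begin
      q ^ ((k + suc j) * suc d)              ≡⟨ cong (q ^_) (solve 3 (λ k j d → (k :+ (con 1 :+ j)) :* (con 1 :+ d)
                                                   := (k :+ d :* k) :+ (j :* (con 1 :+ d) :+ (con 1 :+ d))) refl k j d) ⟩
      q ^ (k + d * k + (j * suc d + suc d))  ≡⟨ ℕₚ.^-distribˡ-+-* q (k + d * k) _ ⟩
      q ^ (k + d * k) * q ^ (j * suc d + suc d)
        ≡⟨ cong₂ _*_ (ℕₚ.^-distribˡ-+-* q k (d * k)) (ℕₚ.^-distribˡ-+-* q (j * suc d) (suc d)) ⟩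
      q ^ k * q ^ (d * k) * (X * (q * q ^ d)) ∎

module _ {q : ℕ} (𝔽 : FiniteField q) {A B : Set} (h : A → B) where
  open FiniteField 𝔽 using (allFuns)

  tabulateₕ : ∀ {m} → (Fin m → A) → Vec B m
  tabulateₕ f = Vec.tabulate (h ∘ f)

  map-tabulate-allFuns : ∀ m (xs : List A) → map tabulateₕ (allFuns m xs) ≡ allVecs m (map h xs)
  map-tabulate-allFuns zero xs = refl
  map-tabulate-allFuns (suc m) xs =
    trans (Listₚ.map-concatMap (tabulateₕ {suc m}) _ xs)
      (trans (Listₚ.concatMap-cong (λ x → map-prepend x _ (λ _ → refl)) xs) (concatMap≡cartesianProductWith xs))
    where
    open ≡-Reasoning
    fs = allFuns m xs
    vs = allVecs m (map h xs)
    map-prepend : ∀ x (c : (Fin m → A) → Fin (suc m) → A) → (∀ f → tabulateₕ (c f) ≡ h x ∷ tabulateₕ f) →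
                  map tabulateₕ (map c fs) ≡ map (h x ∷_) vs
    map-prepend x c tabulate-c = begin
      map tabulateₕ (map c fs)          ≡⟨ Listₚ.map-∘ fs ⟨
      map (tabulateₕ ∘ c) fs            ≡⟨ Listₚ.map-cong tabulate-c fs ⟩
      map ((h x ∷_) ∘ tabulateₕ) fs     ≡⟨ Listₚ.map-∘ fs ⟩
      map (h x ∷_) (map tabulateₕ fs)   ≡⟨ cong (map (h x ∷_)) (map-tabulate-allFuns m xs) ⟩
      map (h x ∷_) vs                   ∎
    concatMap≡cartesianProductWith : ∀ ys → List.concatMap (λ x → map (h x ∷_) vs) ys ≡ cartesianProductWith _∷_ (map h ys) vs
    concatMap≡cartesianProductWith [] = refl
    concatMap≡cartesianProductWith (y ∷ ys) = cong (map (h y ∷_) vs ++_) (concatMap≡cartesianProductWith ys)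

module SampleSpace {q : ℕ} (𝔽 : FiniteField q) (n d k : ℕ) where
  open FiniteField 𝔽 using (F; elements; fCoeff; xCoeffs; GCDDegree; DegCon≡; sampleSpace; allFuns)
  open Columns 𝔽 d
  open Counting 𝔽 d

  xCoefficient : ∀ m (a : Fin m → Fin (suc d) → F) j →
                 List.tabulate {n = suc m} (λ i → fCoeff a i j) ≡ column j (Vec.tabulate (λ i → a i j))
  xCoefficient zero    a zero    = refl
  xCoefficient zero    a (suc j) = refl
  xCoefficient (suc m) a j       = cong (a zero j ∷_) (xCoefficient m (a ∘ suc) j)

  xCoeffs≡colList : ∀ a → xCoeffs a ≡ colList (columnsOf a)
  xCoeffs≡colList a = Listₚ.tabulate-cong λ j →
    trans (xCoefficient n a j) (cong (column j) (sym (Vecₚ.lookup∘tabulate (λ j → Vec.tabulate (λ i → a i j)) j)))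

  degCon≡⇒gcdDegree≡ : ∀ a → DegCon≡ n d k a → gcdDegree (columnsOf a) ≡ k
  degCon≡⇒gcdDegree≡ a deg = GCDDegree⇒gcdDegree (columnsOf a) (subst (λ cs → GCDDegree cs k) (xCoeffs≡colList a) deg)

  gcdDegree≡⇒degCon≡ : ∀ a → gcdDegree (columnsOf a) ≡ k → DegCon≡ n d k a
  gcdDegree≡⇒degCon≡ a e = subst (λ cs → GCDDegree cs k) (sym (xCoeffs≡colList a)) (gcdDegree⇒GCDDegree (columnsOf a) e)

  degCon≡? : Decidable (DegCon≡ n d k)
  degCon≡? a = map′ (gcdDegree≡⇒degCon≡ a) (degCon≡⇒gcdDegree≡ a) (gcdDegree (columnsOf a) ℕ.≟ k)

  count-degCon≡ : count degCon≡? (sampleSpace n d) ≡ #gcdDegree n k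
  count-degCon≡ = begin
    count degCon≡? (sampleSpace n d)
      ≡⟨ count-≐ degCon≡? (P? ∘ transposeᵥ ∘ rowsOf)
           ((λ {a} → subst P (columnsOf≡transposeᵥ∘rowsOf a) ∘ degCon≡⇒gcdDegree≡ a) ,
            (λ {a} → gcdDegree≡⇒degCon≡ a ∘ subst P (sym (columnsOf≡transposeᵥ∘rowsOf a))))
           (sampleSpace n d) ⟩
    count (P? ∘ transposeᵥ ∘ rowsOf) (sampleSpace n d)
      ≡⟨ count-map (P? ∘ transposeᵥ) rowsOf (sampleSpace n d) ⟨
    count (P? ∘ transposeᵥ) (map rowsOf (sampleSpace n d))
      ≡⟨ cong (count (P? ∘ transposeᵥ)) rows ⟩
    count (P? ∘ transposeᵥ) (allVecs n (allVecsF (suc d)))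
      ≡⟨ count-bijection transposeᵥ transposeᵥ-injective
           (allVecs-unique n (allVecs-unique (suc d) elements-unique)) (allColumns-unique n)
           (allVecs-complete n (allVecs-complete (suc d) elements-complete)) (allColumns-complete n)
           P? (λ {C} _ → transposeᵥ C , transposeᵥ-involutive C) ⟨
    #gcdDegree n k ∎
    where
    open ≡-Reasoning
    P : Columns n → Set
    P C = gcdDegree C ≡ k
    P? : Decidable P
    P? C = gcdDegree C ℕ.≟ k
    rows : map rowsOf (sampleSpace n d) ≡ allVecs n (allVecsF (suc d))
    rows = trans (map-tabulate-allFuns 𝔽 (λ g → Vec.tabulate g) n (allFuns (suc d) elements))
                 (cong (allVecs n) (trans (map-tabulate-allFuns 𝔽 id (suc d) elements)
                                          (cong (allVecs (suc d)) (Listₚ.map-id elements))))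

open import Data.Nat using (_+_; _*_; _^_; _∸_; _≤_; _<_)

lemma7p1 : {q : ℕ} (𝔽 : FiniteField q) (d n : ℕ) → 1 ≤ d → 1 ≤ n → (k : ℕ) → k < n →
    Σ (Decidable (FiniteField.DegCon≡ 𝔽 n d k)) (λ dec →
      count dec (FiniteField.sampleSpace 𝔽 n d) * q ^ d * q ^ (d * k)
        ≡ (q ^ d ∸ 1) * q ^ (n * suc d))
lemma7p1 {q} 𝔽 d n _ _ k k<n = degCon≡? , (begin
  count degCon≡? (sampleSpace n d) * q ^ d * q ^ (d * k)
    ≡⟨ cong (λ c → c * q ^ d * q ^ (d * k)) count-degCon≡ ⟩
  #gcdDegree n k * q ^ d * q ^ (d * k)
    ≡⟨ subst (λ m → #gcdDegree m k * q ^ d * q ^ (d * k) ≡ (q ^ d ∸ 1) * q ^ (m * suc d)) n≡k+suc[j] (#gcdDegree-closed k j) ⟩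
  (q ^ d ∸ 1) * q ^ (n * suc d) ∎)
  where
  open ≡-Reasoning
  open FiniteField 𝔽 using (sampleSpace)
  open Counting 𝔽 d
  open SampleSpace 𝔽 n d k
  j = n ∸ suc k
  n≡k+suc[j] : k + suc j ≡ n
  n≡k+suc[j] = trans (ℕₚ.+-suc k j) (ℕₚ.m+[n∸m]≡n k<n)
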